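{- Let $n\ge 1$. With $\mathbf{Q}_n,\mathbf{T}_n$ as in the context, the following identities hold: $$Q(n)=\sum_{i=1}^{2n}(-1)^{i}\binom{4n-i-2}{2n-i}\sum_{s\in S_{4n-2,i}}\mathrm{per}(\mathbf{Q}_n|s),$$ $$T(n)=\sum_{i=1}^{2n}(-1)^{i}\sum_{s\in S_{2n,i}}\mathrm{per}(\mathbf{T}_n|s),$$ $$S(n)=\sum_{\mathbf{M}\in U_n}(-1)^{\gamma(\mathbf{M})+n}\,\mathrm{per}(\mathbf{M})\binom{2n-\gamma(\mathbf{M})-1}{n-\gamma(\mathbf{M})},$$ $$TS(n)=\sum_{\mathbf{M}\in V_n}(-1)^{\sigma(\mathbf{M})+n}\,\mathrm{per}(\mathbf{M}).$$
   Context: $\mathrm{per}(A)=\sum_{\sigma\in S_n}\prod_i a_{i,\sigma(i)}$. $\mathbf{Q}_n$ is the $n\times n$ matrix in the $4n-2$ variables $x_1,\dots,x_{2n-1},y_1,\dots,y_{2n-1}$ with $(i,j)$ entry $x_{n-i+j}y_{2n-i-j+1}$; $\mathbf{T}_n$ is the $n\times n$ matrix in the $2n$ variables $x_r,y_r$ ($r\in\mathbb{Z}/n\mathbb{Z}$) with $(i,j)$ entry $x_{(n-i+j)\bmod n}y_{(2n-i-j+1)\bmod n}$. Fix an ordering of the variables of each matrix; $S_{m,k}=\{s\in\{0,1\}^m:\sum s_i=k\}$, and for a matrix $\mathbf{A}$ in $m$ variables and $s\in\{0,1\}^m$, $\mathbf{A}|s$ is the $(0,1)$ matrix obtained by substituting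 the $l$-th variable by $s_l$. $U_n$ is the set of all $n\times n$ $(0,1)$ matrices that are diagonally constant ($m_{i,j}=m_{i+1,j+1}$), and $\gamma(\mathbf{M})$ is the number of its northwest-southeast diagonals (out of $2n-1$) whose entries are $1$. $V_n$ is the set of all $n\times n$ $(0,1)$ circulant matrices ($m_{i,j}=m_{i+1,(j+1)\bmod n}$, indices mod $n$), and $\sigma(\mathbf{M})$ is the number of ones in the first row. Binomial coefficients $\binom{a}{b}$ with $b<0$ are $0$. Board squares are $(i,j)$ (row $i$, column $j$). $Q(n)$: number of placements of $n$ queens on the $n\times n$ board with no two sharing a row, column, value of $j-i$, or value of $i+j$. $S(n)$: number of placements of $n$ pieces with no two sharing a row, column, or value of $j-i$. $T(n)$: same as $Q(n)$ but with $j-i$ and $i+j$ taken mod $n$. $TS(n)$: same as $S(n)$ but with $j-i$ taken mod $n$. -}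

module Defs where

open import Data.Bool using (Bool; true; false; _∧_; _∨_; not; if_then_else_)
open import Data.Nat as ℕ using (ℕ; zero; suc; _+_; _*_; _∸_; _≡ᵇ_; _<ᵇ_; _%_)
open import Data.Nat.Combinatorics using (_C_)
open import Data.Fin using (Fin; toℕ)
open import Data.Vec as Vec using (Vec; []; _∷_; lookup)
open import Data.List as List using (List; []; _∷_; map; concatMap; filterᵇ; length; allFin; foldr)
open import Data.Integer as ℤ using (ℤ; +_; -[1+_]; _-_)
open import Data.Nat.ListAction renaming (sum to ℕsum; product to ℕprod)

vecsOf : {A : Set} → List A → (m : ℕ) → List (Vec A m)
vecsOf xs zero    = Vec.[] ∷ []
vecsOf xs (suc m) = concatMap (λ x → map (x Vec.∷_) (vecsOf xs m)) xs

bools : List Bool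
bools = false ∷ true ∷ []

allB : {A : Set} → List A → (A → Bool) → Bool
allB xs p = foldr (λ x b → p x ∧ b) true xs

countB : {A : Set} → List A → (A → Bool) → ℕ
countB xs p = length (filterᵇ p xs)

sumℤ : List ℤ → ℤ
sumℤ = foldr ℤ._+_ (+ 0)

sgn : ℕ → ℤ
sgn k = (ℤ.- (+ 1)) ℤ.^ k

-- binomial coefficient with integer lower index; zero if b < 0
-- (and, as usual, zero if b > a)
binomZ : ℕ → ℤ → ℕ
binomZ a (+ b)      = a C b
binomZ a -[1+ b ]   = 0

bit : Bool → ℕ
bit true  = 1
bit false = 0

-- 1-based row/column index of a Fin n
idx : {n : ℕ} → Fin n → ℕ
idx i = suc (toℕ i)

-- reduction mod n (n ≥ 1 in all uses)
modn : ℕ → ℕ → ℕ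
modn zero    a = a
modn (suc k) a = a % suc k

-- k-th entry (0-based) of a bit vector, false if out of range
nth : {m : ℕ} → Vec Bool m → ℕ → Bool
nth []       _       = false
nth (b ∷ bs) zero    = b
nth (b ∷ bs) (suc k) = nth bs k

Mat : ℕ → Set
Mat n = Fin n → Fin n → ℕ

-- permutations of Fin n, as the injective maps (listed as vectors)
injectiveᵇ : {n : ℕ} → Vec (Fin n) n → Bool
injectiveᵇ {n} σ = allB (allFin n) λ i → allB (allFin n) λ j →
  (toℕ i ≡ᵇ toℕ j) ∨ not (toℕ (lookup σ i) ≡ᵇ toℕ (lookup σ j))

perms : (n : ℕ) → List (Vec (Fin n) n)
perms n = filterᵇ injectiveᵇ (vecsOf (allFin n) n)

per : {n : ℕ} → Mat n → ℕ
per {n} A = ℕsum (map (λ σ → ℕprod (map (λ i → A i (lookup σ i)) (allFin n))) (perms n))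

-- variables of Q_n ordered x_1..x_{2n-1}, y_1..y_{2n-1};
-- s has length 4n-2; x_k ↦ s[k-1], y_k ↦ s[(2n-1)+(k-1)]
Qsub : (n : ℕ) → Vec Bool (4 * n ∸ 2) → Mat n
Qsub n s i j =
  bit (nth s ((n ∸ idx i + idx j) ∸ 1)) *
  bit (nth s ((2 * n ∸ 1) + ((2 * n ∸ idx i ∸ idx j + 1) ∸ 1)))

-- variables of T_n ordered x_0..x_{n-1}, y_0..y_{n-1} (indices in ℤ/nℤ);
-- s has length 2n; x_r ↦ s[r], y_r ↦ s[n+r]
Tsub : (n : ℕ) → Vec Bool (2 * n) → Mat n
Tsub n s i j =
  bit (nth s (modn n (n ∸ idx i + idx j))) *
  bit (nth s (n + modn n (2 * n ∸ idx i ∸ idx j + 1)))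

Smk : (m k : ℕ) → List (Vec Bool m)
Smk m k = filterᵇ (λ s → countB (Vec.toList s) (λ b → b) ≡ᵇ k) (vecsOf bools m)

BMat : ℕ → Set
BMat n = Vec (Vec Bool n) n

entry : {n : ℕ} → BMat n → Fin n → Fin n → Bool
entry M i j = lookup (lookup M i) j

toMat : {n : ℕ} → BMat n → Mat n
toMat M i j = bit (entry M i j)

allBMats : (n : ℕ) → List (BMat n)
allBMats n = vecsOf (vecsOf bools n) n

beq : Bool → Bool → Bool
beq true  b = b
beq false b = not b

diagConstᵇ : {n : ℕ} → BMat n → Bool
diagConstᵇ {n} M = allB (allFin n) λ i → allB (allFin n) λ j →
  allB (allFin n) λ i' → allB (allFin n) λ j' →
    not ((idx i' ≡ᵇ idx i + 1) ∧ (idx j' ≡ᵇ idx j + 1)) ∨ beq (entry M i j) (entry M i' j')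

U : (n : ℕ) → List (BMat n)
U n = filterᵇ diagConstᵇ (allBMats n)

-- γ(M): number of the 2n-1 NW-SE diagonals j - i = d - (n-1), d = 0..2n-2,
-- all of whose entries are 1
γ : {n : ℕ} → BMat n → ℕ
γ {n} M = countB (List.upTo (2 * n ∸ 1)) λ d →
  allB (allFin n) λ i → allB (allFin n) λ j →
    not (idx j + (n ∸ 1) ≡ᵇ idx i + d) ∨ entry M i j

circᵇ : {n : ℕ} → BMat n → Bool
circᵇ {n} M = allB (allFin n) λ i → allB (allFin n) λ j →
  allB (allFin n) λ i' → allB (allFin n) λ j' →
    not ((toℕ i' ≡ᵇ modn n (toℕ i + 1)) ∧ (toℕ j' ≡ᵇ modn n (toℕ j + 1))) ∨ beq (entry M i j) (entry M i' j')

V : (n : ℕ) → List (BMat n)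
V n = filterᵇ circᵇ (allBMats n)

σ₁ : {n : ℕ} → BMat n → ℕ
σ₁ {zero}  M = 0
σ₁ {suc n} M = countB (Vec.toList (Vec.head M)) (λ b → b)

-- Board counts.  A placement of n pieces with no two in a row is given by
-- the column f(i) of the piece in row i (1-based squares (i,j)).

placements : (n : ℕ) → ((i j i' j' : ℕ) → Bool) → ℕ
placements n ok = countB (vecsOf (allFin n) n) λ f →
  allB (allFin n) λ i → allB (allFin n) λ i' →
    (toℕ i ≡ᵇ toℕ i') ∨ ok (idx i) (idx (lookup f i)) (idx i') (idx (lookup f i'))

-- j - i ≠ j' - i'  (as integers)
diffNe : (i j i' j' : ℕ) → Bool
diffNe i j i' j' = not (j + i' ≡ᵇ j' + i)

sumNe : (i j i' j' : ℕ) → Bool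
sumNe i j i' j' = not (i + j ≡ᵇ i' + j')

-- j - i mod n (computed as (n + j - i) mod n, valid since 1 ≤ i ≤ n)
diffNeMod : ℕ → (i j i' j' : ℕ) → Bool
diffNeMod n i j i' j' = not (modn n (n + j ∸ i) ≡ᵇ modn n (n + j' ∸ i'))

sumNeMod : ℕ → (i j i' j' : ℕ) → Bool
sumNeMod n i j i' j' = not (modn n (i + j) ≡ᵇ modn n (i' + j'))

colNe : (i j i' j' : ℕ) → Bool
colNe i j i' j' = not (j ≡ᵇ j')

Qc : ℕ → ℕ
Qc n = placements n λ i j i' j' → colNe i j i' j' ∧ diffNe i j i' j' ∧ sumNe i j i' j'

Sc : ℕ → ℕ
Sc n = placements n λ i j i' j' → colNe i j i' j' ∧ diffNe i j i' j'

Tc : ℕ → ℕ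
Tc n = placements n λ i j i' j' → colNe i j i' j' ∧ diffNeMod n i j i' j' ∧ sumNeMod n i j i' j'

TSc : ℕ → ℕ
TSc n = placements n λ i j i' j' → colNe i j i' j' ∧ diffNeMod n i j i' j'

sumFrom1 : ℕ → (ℕ → ℤ) → ℤ
sumFrom1 m f = sumℤ (map (λ k → f (suc k)) (List.upTo m))

Qrhs : ℕ → ℤ
Qrhs n = sumFrom1 (2 * n) λ i →
  sgn i ℤ.* (+ ((4 * n ∸ i ∸ 2) C (2 * n ∸ i))) ℤ.*
  (+ ℕsum (map (λ s → per (Qsub n s)) (Smk (4 * n ∸ 2) i)))

Trhs : ℕ → ℤ
Trhs n = sumFrom1 (2 * n) λ i →
  sgn i ℤ.* (+ ℕsum (map (λ s → per (Tsub n s)) (Smk (2 * n) i)))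

Srhs : ℕ → ℤ
Srhs n = sumℤ (map (λ M → sgn (γ M + n) ℤ.* (+ per (toMat M)) ℤ.*
  (+ binomZ (2 * n ∸ γ M ∸ 1) ((+ n) - (+ γ M)))) (U n))

TSrhs : ℕ → ℤ
TSrhs n = sumℤ (map (λ M → sgn (σ₁ M + n) ℤ.* (+ per (toMat M))) (V n))

-- Expand each permanent over permutations σ. For a 0-1 substitution s, the term of σ in per(Q_n | s)
-- is 1 exactly when s contains every variable of the monomial ∏_i q_{i,σ(i)}: one x-variable per
-- occupied NW-SE diagonal and one y-variable per occupied NE-SW diagonal. Hence σ is a queens
-- placement iff these 2n variables are pairwise distinct. Summing w(|s|) [vars σ ⊆ s] over all s
-- gives ∑_j C(m-d, j) w(d+j), where m is the number of variables and d the number of distinct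
-- variables of σ; for w(k) = (-1)^(c-k) C(m-k, c-k) with c = 2n this is [d = c] by binomial
-- inversion, and these are exactly the coefficients of the formulas for Q(n) and T(n) (for T_n,
-- m = c = 2n). For S(n) and TS(n) the same argument runs over the 2n-1 diagonals (the n broken
-- diagonals) of the board: a diagonally constant (circulant) 0-1 matrix is the same as a 0-1
-- vector indexed by them, and γ (σ₁) counts its ones.

module Submission where

open import Defs
open import Data.Bool using (Bool; true; false; _∧_; _∨_; not; if_then_else_)
import Data.Bool.Properties as Boolₚ
open import Data.Nat as ℕ using (ℕ; zero; suc; _∸_; _≤_; _<_; z≤n; s≤s; _≡ᵇ_; _%_)
open import Data.Nat.DivMod using (_mod_; m%n<n; m<n⇒m%n≡m; m%n%n≡m%n; [m+n]%n≡m%n; [m+kn]%n≡m%n; %-distribˡ-+)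
import Data.Nat.Properties as ℕₚ
open import Data.Nat.Combinatorics using (_C_; nCk+nC[k+1]≡[n+1]C[k+1]; nCn≡1)
open import Data.Nat.ListAction renaming (sum to ℕsum; product to ℕprod)
open import Data.Fin using (Fin; toℕ; fromℕ<) renaming (zero to fzero; suc to fsuc)
import Data.Fin.Properties as Finₚ
open import Data.List as List using (List; []; _∷_; map; length; filterᵇ; concatMap; _++_; allFin; tabulate; upTo)
import Data.List.Properties as Listₚ
open import Data.List.Relation.Unary.All as All using (All; []; _∷_)
import Data.List.Relation.Unary.All.Properties as Allₚ
open import Data.Vec as Vec using (Vec; []; _∷_; lookup)
import Data.Vec.Properties as Vecₚ
open import Data.Integer using (ℤ; +_; -[1+_]; _+_; _*_; -_; _-_)
import Data.Integer.Properties as ℤₚ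
open import Data.Integer.Solver using (module +-*-Solver)
open import Data.Product using (_×_; _,_; proj₁; proj₂)
open import Function using (_∘_; Equivalence; mk⇔)
open import Relation.Nullary using (contradiction; yes; no)
open import Relation.Nullary.Decidable using (does; does-⇔; dec-false)
open import Relation.Binary.Definitions using (DecidableEquality)
open import Relation.Binary.PropositionalEquality
open import Algebra.Bundles using (CommutativeMonoid)
import Algebra.Properties.CommutativeSemigroup as CommSemigroupₚ
module ℤ+ = CommSemigroupₚ ℤₚ.+-commutativeSemigroup
module ℕ* = CommSemigroupₚ ℕₚ.*-commutativeSemigroup
module ∧ = CommSemigroupₚ (CommutativeMonoid.commutativeSemigroup Boolₚ.∧-commutativeMonoid)
open +-*-Solver using (solve; _:+_; _:-_; _:*_; :-_; _:=_; con)

∑ : {A : Set} → List A → (A → ℤ) → ℤ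
∑ xs f = sumℤ (map f xs)

∑-syntax : {A : Set} → List A → (A → ℤ) → ℤ
∑-syntax = ∑

infix 5 ∑-syntax
syntax ∑-syntax xs (λ x → e) = ∑[ x ∈ xs ] e

private variable A B : Set

≡⇒≡ᵇ-true : ∀ a b → a ≡ b → (a ≡ᵇ b) ≡ true
≡⇒≡ᵇ-true a b a≡b = Equivalence.to Boolₚ.T-≡ (ℕₚ.≡⇒≡ᵇ a b a≡b)

≡ᵇ-true⇒≡ : ∀ a b → (a ≡ᵇ b) ≡ true → a ≡ b
≡ᵇ-true⇒≡ a b a≡ᵇb = ℕₚ.≡ᵇ⇒≡ a b (Equivalence.from Boolₚ.T-≡ a≡ᵇb)

≡ᵇ-sym : ∀ a b → (a ≡ᵇ b) ≡ (b ≡ᵇ a)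
≡ᵇ-sym zero    zero    = refl
≡ᵇ-sym zero    (suc b) = refl
≡ᵇ-sym (suc a) zero    = refl
≡ᵇ-sym (suc a) (suc b) = ≡ᵇ-sym a b

≡ᵇ-⇔ : ∀ a b c d → (a ≡ b → c ≡ d) → (c ≡ d → a ≡ b) → (a ≡ᵇ b) ≡ (c ≡ᵇ d)
≡ᵇ-⇔ a b c d to from = does-⇔ (mk⇔ to from) (a ℕₚ.≟ b) (c ℕₚ.≟ d)

∧-true : ∀ {a b} → a ∧ b ≡ true → a ≡ true × b ≡ true
∧-true {true} {true} _ = refl , refl

bool-ext : ∀ {a b} → (a ≡ true → b ≡ true) → (b ≡ true → a ≡ true) → a ≡ b
bool-ext {true}  {true}  _ _ = refl
bool-ext {true}  {false} f _ = sym (f refl)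
bool-ext {false} {true}  _ g = g refl
bool-ext {false} {false} _ _ = refl

beq-sound : ∀ a b → beq a b ≡ true → a ≡ b
beq-sound true  true  _ = refl
beq-sound false false _ = refl

beq-refl : ∀ a → beq a a ≡ true
beq-refl true  = refl
beq-refl false = refl

∑-++ : (xs ys : List A) (f : A → ℤ) → ∑ (xs ++ ys) f ≡ ∑ xs f + ∑ ys f
∑-++ []       ys f = sym (ℤₚ.+-identityˡ _)
∑-++ (x ∷ xs) ys f = trans (cong (_+_ (f x)) (∑-++ xs ys f)) (sym (ℤₚ.+-assoc (f x) _ _))

∑-cong : (xs : List A) {f g : A → ℤ} → (∀ x → f x ≡ g x) → ∑ xs f ≡ ∑ xs g
∑-cong xs f≗g = cong sumℤ (Listₚ.map-cong f≗g xs)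

∑-zero : (xs : List A) → ∑[ x ∈ xs ] + 0 ≡ + 0
∑-zero []       = refl
∑-zero (x ∷ xs) = trans (ℤₚ.+-identityˡ _) (∑-zero xs)

∑-+ : (xs : List A) (f g : A → ℤ) → ∑[ x ∈ xs ] (f x + g x) ≡ ∑ xs f + ∑ xs g
∑-+ []       f g = refl
∑-+ (x ∷ xs) f g = trans (cong (_+_ (f x + g x)) (∑-+ xs f g))
  (ℤ+.interchange (f x) (g x) (∑ xs f) (∑ xs g))

∑-*ˡ : (c : ℤ) (xs : List A) (f : A → ℤ) → c * ∑ xs f ≡ ∑[ x ∈ xs ] c * f x
∑-*ˡ c []       f = ℤₚ.*-zeroʳ c
∑-*ˡ c (x ∷ xs) f = trans (ℤₚ.*-distribˡ-+ c (f x) _) (cong (_+_ (c * f x)) (∑-*ˡ c xs f))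

∑-swap : (xs : List A) (ys : List B) (f : A → B → ℤ) →
  ∑[ x ∈ xs ] ∑[ y ∈ ys ] f x y ≡ ∑[ y ∈ ys ] ∑[ x ∈ xs ] f x y
∑-swap []       ys f = sym (∑-zero ys)
∑-swap (x ∷ xs) ys f = trans (cong (_+_ (∑ ys (f x))) (∑-swap xs ys f))
  (sym (∑-+ ys (f x) (λ y → ∑[ x' ∈ xs ] f x' y)))

∑-filter : (p : A → Bool) (xs : List A) (f : A → ℤ) →
  ∑ (filterᵇ p xs) f ≡ ∑[ x ∈ xs ] (if p x then f x else + 0)
∑-filter p []       f = refl
∑-filter p (x ∷ xs) f with p x
... | true  = cong (_+_ (f x)) (∑-filter p xs f)
... | false = trans (∑-filter p xs f) (sym (ℤₚ.+-identityˡ _))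

+sum≡∑ : (f : A → ℕ) (xs : List A) → + ℕsum (map f xs) ≡ ∑[ x ∈ xs ] + f x
+sum≡∑ f []       = refl
+sum≡∑ f (x ∷ xs) = trans (ℤₚ.pos-+ (f x) _) (cong (_+_ (+ f x)) (+sum≡∑ f xs))

+countB≡∑ : (xs : List A) (p : A → Bool) → + countB xs p ≡ ∑[ x ∈ xs ] + bit (p x)
+countB≡∑ []       p = refl
+countB≡∑ (x ∷ xs) p with p x
... | true  = trans (ℤₚ.pos-+ 1 _) (cong (_+_ (+ 1)) (+countB≡∑ xs p))
... | false = trans (+countB≡∑ xs p) (sym (ℤₚ.+-identityˡ _))

∑-map : (g : B → A) (ys : List B) (f : A → ℤ) → ∑ (map g ys) f ≡ ∑ ys (f ∘ g)
∑-map g ys f = cong sumℤ (sym (Listₚ.map-∘ ys))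

∑-concatMap : (g : B → List A) (ys : List B) (f : A → ℤ) →
  ∑ (concatMap g ys) f ≡ ∑[ y ∈ ys ] ∑ (g y) f
∑-concatMap g []       f = refl
∑-concatMap g (y ∷ ys) f = trans (∑-++ (g y) _ f) (cong (_+_ (∑ (g y) f)) (∑-concatMap g ys f))

∑-vecsOf-suc : (xs : List A) (m : ℕ) (f : Vec A (suc m) → ℤ) →
  ∑ (vecsOf xs (suc m)) f ≡ ∑[ x ∈ xs ] ∑[ v ∈ vecsOf xs m ] f (x ∷ v)
∑-vecsOf-suc xs m f = trans (∑-concatMap _ xs f) (∑-cong xs (λ x → ∑-map (x ∷_) (vecsOf xs m) f))

∑-bools : (f : Bool → ℤ) → ∑ bools f ≡ f false + f true
∑-bools f = cong (_+_ (f false)) (ℤₚ.+-identityʳ (f true))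

-- Binomial inversion

-- binomialSum p V = ∑_{j ≤ p} C(p, j) V(j), computed by Pascal's rule.
binomialSum : ℕ → (ℕ → ℤ) → ℤ
binomialSum zero    V = V 0
binomialSum (suc p) V = binomialSum p V + binomialSum p (V ∘ suc)

binomialSum-cong : ∀ p {V W : ℕ → ℤ} → (∀ j → j ≤ p → V j ≡ W j) → binomialSum p V ≡ binomialSum p W
binomialSum-cong zero    V≗W = V≗W 0 z≤n
binomialSum-cong (suc p) V≗W = cong₂ _+_
  (binomialSum-cong p (λ j j≤p → V≗W j (ℕₚ.m≤n⇒m≤1+n j≤p)))
  (binomialSum-cong p (λ j j≤p → V≗W (suc j) (s≤s j≤p)))

binomialSum-zero : ∀ p → binomialSum p (λ _ → + 0) ≡ + 0
binomialSum-zero zero    = refl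
binomialSum-zero (suc p) = cong₂ _+_ (binomialSum-zero p) (binomialSum-zero p)

binomialSum-head : ∀ p (V : ℕ → ℤ) → (∀ j → V (suc j) ≡ + 0) → binomialSum p V ≡ V 0
binomialSum-head zero    V V≡0 = refl
binomialSum-head (suc p) V V≡0 = begin
  binomialSum p V + binomialSum p (V ∘ suc)
    ≡⟨ cong₂ _+_ (binomialSum-head p V V≡0) (binomialSum-cong p (λ j _ → V≡0 j)) ⟩
  V 0 + binomialSum p (λ _ → + 0)
    ≡⟨ cong (_+_ (V 0)) (binomialSum-zero p) ⟩
  V 0 + + 0
    ≡⟨ ℤₚ.+-identityʳ (V 0) ⟩
  V 0 ∎
  where open ≡-Reasoning

binomialSum-- : ∀ p (V W : ℕ → ℤ) → binomialSum p (λ j → V j - W j) ≡ binomialSum p V - binomialSum p W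
binomialSum-- zero    V W = refl
binomialSum-- (suc p) V W = trans
  (cong₂ _+_ (binomialSum-- p V W) (binomialSum-- p (V ∘ suc) (W ∘ suc)))
  (solve 4 (λ a b c d → (a :- b) :+ (c :- d) := (a :+ c) :- (b :+ d)) refl
    (binomialSum p V) (binomialSum p W) (binomialSum p (V ∘ suc)) (binomialSum p (W ∘ suc)))

δ₀ : ℕ → ℤ
δ₀ zero    = + 1
δ₀ (suc _) = + 0

-- exactWeight m c k = (-1)^(c-k) C(m-k, c-k), and 0 for k > c.
exactWeight : ℕ → ℕ → ℕ → ℤ
exactWeight p       q       zero    = sgn q * + (p C q)
exactWeight p       zero    (suc j) = + 0
exactWeight zero    (suc q) (suc j) = exactWeight zero q j
exactWeight (suc p) (suc q) (suc j) = exactWeight p q j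

exactWeight-≤ : ∀ p q j → j ≤ q → exactWeight p q j ≡ sgn (q ∸ j) * + ((p ∸ j) C (q ∸ j))
exactWeight-≤ p       q       zero    _         = refl
exactWeight-≤ zero    (suc q) (suc j) (s≤s j≤q) = trans (exactWeight-≤ zero q j j≤q)
  (cong (λ z → sgn (q ∸ j) * + (z C (q ∸ j))) (ℕₚ.0∸n≡0 j))
exactWeight-≤ (suc p) (suc q) (suc j) (s≤s j≤q) = exactWeight-≤ p q j j≤q

exactWeight-> : ∀ p q j → q < j → exactWeight p q j ≡ + 0
exactWeight-> p       zero    (suc j) _         = refl
exactWeight-> zero    (suc q) (suc j) (s≤s q<j) = exactWeight-> zero q j q<j
exactWeight-> (suc p) (suc q) (suc j) (s≤s q<j) = exactWeight-> p q j q<j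

exactWeight-shift : ∀ m c d j → d ≤ c → exactWeight m c (d ℕ.+ j) ≡ exactWeight (m ∸ d) (c ∸ d) j
exactWeight-shift m       c       zero    j _         = refl
exactWeight-shift zero    (suc c) (suc d) j (s≤s d≤c) = trans (exactWeight-shift zero c d j d≤c)
  (cong (λ z → exactWeight z (c ∸ d) j) (ℕₚ.0∸n≡0 d))
exactWeight-shift (suc m) (suc c) (suc d) j (s≤s d≤c) = exactWeight-shift m c d j d≤c

exactWeight-pascal : ∀ p q j → j ≤ p →
  exactWeight (suc p) (suc q) j ≡ exactWeight p (suc q) j - exactWeight p q j
exactWeight-pascal p q zero _ = begin
  sgn (suc q) * + (suc p C suc q)
    ≡⟨ cong (λ z → sgn (suc q) * + z) (sym (nCk+nC[k+1]≡[n+1]C[k+1] p q)) ⟩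
  sgn (suc q) * + (p C q ℕ.+ p C suc q)
    ≡⟨ cong (sgn (suc q) *_) (ℤₚ.pos-+ (p C q) (p C suc q)) ⟩
  (- (+ 1) * sgn q) * (+ (p C q) + + (p C suc q))
    ≡⟨ solve 3 (λ s x y → (:- con (+ 1) :* s) :* (x :+ y) := (:- con (+ 1) :* s) :* y :- s :* x)
         refl (sgn q) (+ (p C q)) (+ (p C suc q)) ⟩
  sgn (suc q) * + (p C suc q) - sgn q * + (p C q) ∎
  where open ≡-Reasoning
exactWeight-pascal (suc p) zero    (suc j) (s≤s j≤p) = trans (δ-weight j) (sym (ℤₚ.+-identityʳ _))
  where
  δ-weight : ∀ j → exactWeight (suc p) 0 j ≡ exactWeight p 0 j
  δ-weight zero    = refl
  δ-weight (suc j) = refl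
exactWeight-pascal (suc p) (suc q) (suc j) (s≤s j≤p) = exactWeight-pascal p q j j≤p

binomialSum-exactWeight : ∀ p q → binomialSum p (exactWeight p q) ≡ δ₀ q
binomialSum-exactWeight zero    zero    = refl
binomialSum-exactWeight zero    (suc q) = ℤₚ.*-zeroʳ (sgn (suc q))
binomialSum-exactWeight (suc p) zero    = trans
  (cong₂ _+_ (binomialSum-head p (exactWeight (suc p) 0) (λ _ → refl)) (binomialSum-zero p)) refl
binomialSum-exactWeight (suc p) (suc q) = begin
  binomialSum p (exactWeight (suc p) (suc q)) + binomialSum p (exactWeight p q)
    ≡⟨ cong (_+ binomialSum p (exactWeight p q))
         (trans (binomialSum-cong p (exactWeight-pascal p q))
                (binomialSum-- p (exactWeight p (suc q)) (exactWeight p q))) ⟩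
  (binomialSum p (exactWeight p (suc q)) - binomialSum p (exactWeight p q)) + binomialSum p (exactWeight p q)
    ≡⟨ solve 2 (λ a b → (a :- b) :+ b := a) refl _ _ ⟩
  binomialSum p (exactWeight p (suc q))
    ≡⟨ binomialSum-exactWeight p (suc q) ⟩
  + 0 ∎
  where open ≡-Reasoning

-- Inclusion–exclusion over the supersets of a set of positions

ones : {m : ℕ} → Vec Bool m → ℕ
ones []      = 0
ones (b ∷ v) = bit b ℕ.+ ones v

ones≤length : {m : ℕ} (r : Vec Bool m) → ones r ≤ m
ones≤length []          = z≤n
ones≤length (true ∷ r)  = s≤s (ones≤length r)
ones≤length (false ∷ r) = ℕₚ.m≤n⇒m≤1+n (ones≤length r)

infix 4 _⊆ᵇ_
_⊆ᵇ_ : {m : ℕ} → Vec Bool m → Vec Bool m → Bool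
[]          ⊆ᵇ []      = true
(false ∷ r) ⊆ᵇ (b ∷ s) = r ⊆ᵇ s
(true ∷ r)  ⊆ᵇ (b ∷ s) = b ∧ (r ⊆ᵇ s)

∑-supersets : ∀ m (r : Vec Bool m) (W : ℕ → ℤ) →
  ∑[ s ∈ vecsOf bools m ] (if r ⊆ᵇ s then W (ones s) else + 0)
    ≡ binomialSum (m ∸ ones r) (λ j → W (ones r ℕ.+ j))
∑-supersets zero    []         W = ℤₚ.+-identityʳ (W 0)
∑-supersets (suc m) (true ∷ r) W = begin
  ∑ (vecsOf bools (suc m)) F
    ≡⟨ trans (∑-vecsOf-suc bools m F) (∑-bools (λ b → ∑[ s ∈ vecsOf bools m ] F (b ∷ s))) ⟩
  ∑ (vecsOf bools m) (λ s → F (false ∷ s)) + ∑ (vecsOf bools m) (λ s → F (true ∷ s))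
    ≡⟨ cong (_+ ∑ (vecsOf bools m) (λ s → F (true ∷ s))) (∑-zero (vecsOf bools m)) ⟩
  + 0 + ∑ (vecsOf bools m) (λ s → if r ⊆ᵇ s then W (suc (ones s)) else + 0)
    ≡⟨ ℤₚ.+-identityˡ _ ⟩
  ∑[ s ∈ vecsOf bools m ] (if r ⊆ᵇ s then W (suc (ones s)) else + 0)
    ≡⟨ ∑-supersets m r (W ∘ suc) ⟩
  binomialSum (m ∸ ones r) (λ j → W (suc (ones r ℕ.+ j))) ∎
  where
  open ≡-Reasoning
  F : Vec Bool (suc m) → ℤ
  F s = if true ∷ r ⊆ᵇ s then W (ones s) else + 0
∑-supersets (suc m) (false ∷ r) W = begin
  ∑ (vecsOf bools (suc m)) F
    ≡⟨ trans (∑-vecsOf-suc bools m F) (∑-bools (λ b → ∑[ s ∈ vecsOf bools m ] F (b ∷ s))) ⟩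
  ∑ (vecsOf bools m) (λ s → F (false ∷ s)) + ∑ (vecsOf bools m) (λ s → F (true ∷ s))
    ≡⟨ cong₂ _+_ (∑-supersets m r W) (∑-supersets m r (W ∘ suc)) ⟩
  binomialSum (m ∸ ones r) Wᵣ + binomialSum (m ∸ ones r) (λ j → W (suc (ones r ℕ.+ j)))
    ≡⟨ cong (_+_ (binomialSum (m ∸ ones r) Wᵣ))
         (binomialSum-cong (m ∸ ones r) (λ j _ → cong W (sym (ℕₚ.+-suc (ones r) j)))) ⟩
  binomialSum (suc (m ∸ ones r)) Wᵣ
    ≡⟨ cong (λ p → binomialSum p Wᵣ) (sym (ℕₚ.+-∸-assoc 1 (ones≤length r))) ⟩
  binomialSum (suc m ∸ ones r) Wᵣ ∎
  where
  open ≡-Reasoning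
  F : Vec Bool (suc m) → ℤ
  F s = if false ∷ r ⊆ᵇ s then W (ones s) else + 0
  Wᵣ : ℕ → ℤ
  Wᵣ j = W (ones r ℕ.+ j)

mark : {m : ℕ} → Vec Bool m → ℕ → Vec Bool m
mark []      l       = []
mark (b ∷ v) zero    = true ∷ v
mark (b ∷ v) (suc l) = b ∷ mark v l

support : (m : ℕ) → List ℕ → Vec Bool m
support m []      = Vec.replicate m false
support m (l ∷ L) = mark (support m L) l

_∈ᵇ_ : ℕ → List ℕ → Bool
x ∈ᵇ []      = false
x ∈ᵇ (y ∷ L) = (x ≡ᵇ y) ∨ (x ∈ᵇ L)

distinctᵇ : List ℕ → Bool
distinctᵇ []      = true
distinctᵇ (x ∷ L) = not (x ∈ᵇ L) ∧ distinctᵇ L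

replicate-⊆ᵇ : {m : ℕ} (s : Vec Bool m) → (Vec.replicate m false ⊆ᵇ s) ≡ true
replicate-⊆ᵇ []      = refl
replicate-⊆ᵇ (b ∷ s) = replicate-⊆ᵇ s

mark-⊆ᵇ : {m : ℕ} (r s : Vec Bool m) (l : ℕ) → l < m → (mark r l ⊆ᵇ s) ≡ nth s l ∧ (r ⊆ᵇ s)
mark-⊆ᵇ (true ∷ r)  (true ∷ s)  zero    _         = refl
mark-⊆ᵇ (true ∷ r)  (false ∷ s) zero    _         = refl
mark-⊆ᵇ (false ∷ r) (c ∷ s)     zero    _         = refl
mark-⊆ᵇ (false ∷ r) (c ∷ s)     (suc l) (s≤s l<m) = mark-⊆ᵇ r s l l<m
mark-⊆ᵇ (true ∷ r)  (c ∷ s)     (suc l) (s≤s l<m) = begin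
  c ∧ (mark r l ⊆ᵇ s)      ≡⟨ cong (c ∧_) (mark-⊆ᵇ r s l l<m) ⟩
  c ∧ (nth s l ∧ (r ⊆ᵇ s)) ≡⟨ sym (Boolₚ.∧-assoc c (nth s l) _) ⟩
  (c ∧ nth s l) ∧ (r ⊆ᵇ s) ≡⟨ cong (_∧ (r ⊆ᵇ s)) (Boolₚ.∧-comm c (nth s l)) ⟩
  (nth s l ∧ c) ∧ (r ⊆ᵇ s) ≡⟨ Boolₚ.∧-assoc (nth s l) c _ ⟩
  nth s l ∧ (c ∧ (r ⊆ᵇ s)) ∎
  where open ≡-Reasoning

support-⊆ᵇ : {m : ℕ} (L : List ℕ) (s : Vec Bool m) → All (_< m) L → (support m L ⊆ᵇ s) ≡ allB L (nth s)
support-⊆ᵇ []      s []           = replicate-⊆ᵇ s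
support-⊆ᵇ (l ∷ L) s (l<m ∷ L<m) =
  trans (mark-⊆ᵇ (support _ L) s l l<m) (cong (nth s l ∧_) (support-⊆ᵇ L s L<m))

nth-replicate : ∀ m l → nth (Vec.replicate m false) l ≡ false
nth-replicate zero    l       = refl
nth-replicate (suc m) zero    = refl
nth-replicate (suc m) (suc l) = nth-replicate m l

nth-mark : {m : ℕ} (r : Vec Bool m) (x l : ℕ) → x < m → nth (mark r x) l ≡ (l ≡ᵇ x) ∨ nth r l
nth-mark (b ∷ r) zero    zero    _         = refl
nth-mark (b ∷ r) zero    (suc l) _         = refl
nth-mark (b ∷ r) (suc x) zero    _         = refl
nth-mark (b ∷ r) (suc x) (suc l) (s≤s x<m) = nth-mark r x l x<m

nth-support : {m : ℕ} (L : List ℕ) (l : ℕ) → All (_< m) L → nth (support m L) l ≡ l ∈ᵇ L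
nth-support {m} []      l []           = nth-replicate m l
nth-support     (x ∷ L) l (x<m ∷ L<m) =
  trans (nth-mark (support _ L) x l x<m) (cong ((l ≡ᵇ x) ∨_) (nth-support L l L<m))

ones-replicate : ∀ m → ones (Vec.replicate m false) ≡ 0
ones-replicate zero    = refl
ones-replicate (suc m) = ones-replicate m

ones-mark : {m : ℕ} (r : Vec Bool m) (x : ℕ) → x < m →
  ones (mark r x) ≡ (if nth r x then ones r else suc (ones r))
ones-mark (true ∷ r)  zero    _ = refl
ones-mark (false ∷ r) zero    _ = refl
ones-mark (b ∷ r)     (suc x) (s≤s x<m) with nth r x | ones-mark r x x<m
... | true  | e = cong (bit b ℕ.+_) e
... | false | e = trans (cong (bit b ℕ.+_) e) (ℕₚ.+-suc (bit b) (ones r))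

ones-pos : {m : ℕ} (r : Vec Bool m) (l : ℕ) → nth r l ≡ true → 1 ≤ ones r
ones-pos (true ∷ r)  zero    _ = s≤s z≤n
ones-pos (true ∷ r)  (suc l) _ = s≤s z≤n
ones-pos (false ∷ r) (suc l) e = ones-pos r l e

-- The number of distinct entries of L is at most its length, with equality iff L has no repeats.
ones-support : {m : ℕ} (L : List ℕ) → All (_< m) L →
  ones (support m L) ≤ length L × δ₀ (length L ∸ ones (support m L)) ≡ + bit (distinctᵇ L)
ones-support {m} []      [] rewrite ones-replicate m = z≤n , refl
ones-support {m} (x ∷ L) (x<m ∷ L<m)
  with ones-support L L<m | ones-mark (support m L) x x<m | nth-support L x L<m
... | (≤len , δ≡) | ones≡ | nth≡ rewrite ones≡ | nth≡ with x ∈ᵇ L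
...   | true  = ℕₚ.m≤n⇒m≤1+n ≤len , cong δ₀ (ℕₚ.+-∸-assoc 1 ≤len)
...   | false = s≤s ≤len , δ≡

ones-support-pos : {m : ℕ} (L : List ℕ) → All (_< m) L → 1 ≤ length L → 1 ≤ ones (support m L)
ones-support-pos {m} (x ∷ L) (x<m ∷ _) _ = ones-pos (mark (support m L) x) x
  (trans (nth-mark (support m L) x x x<m) (cong (_∨ nth (support m L) x) (≡⇒≡ᵇ-true x x refl)))

-- Only weights W k with k ≥ 1 matter, since a nonempty L has only nonempty supersets.
∑-exactWeight-containing : ∀ m c (L : List ℕ) (W : ℕ → ℤ) → All (_< m) L → length L ≡ c → 1 ≤ c →
  (∀ k → 1 ≤ k → k ≤ m → W k ≡ exactWeight m c k) →
  ∑[ s ∈ vecsOf bools m ] (if allB L (nth s) then W (ones s) else + 0) ≡ + bit (distinctᵇ L)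
∑-exactWeight-containing m c L W L<m refl 1≤c W≡ = begin
  ∑[ s ∈ vecsOf bools m ] (if allB L (nth s) then W (ones s) else + 0)
    ≡⟨ ∑-cong (vecsOf bools m) (λ s → cong (λ b → if b then W (ones s) else + 0) (sym (support-⊆ᵇ L s L<m))) ⟩
  ∑[ s ∈ vecsOf bools m ] (if support m L ⊆ᵇ s then W (ones s) else + 0)
    ≡⟨ ∑-supersets m (support m L) W ⟩
  binomialSum (m ∸ d) (λ j → W (d ℕ.+ j))
    ≡⟨ binomialSum-cong (m ∸ d) (λ j j≤m∸d → trans
         (W≡ (d ℕ.+ j) (ℕₚ.≤-trans 1≤d (ℕₚ.m≤m+n d j)) (d+j≤m j j≤m∸d)) (exactWeight-shift m c d j d≤c)) ⟩
  binomialSum (m ∸ d) (exactWeight (m ∸ d) (c ∸ d))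
    ≡⟨ binomialSum-exactWeight (m ∸ d) (c ∸ d) ⟩
  δ₀ (c ∸ d)
    ≡⟨ proj₂ (ones-support L L<m) ⟩
  + bit (distinctᵇ L) ∎
  where
  open ≡-Reasoning
  d : ℕ
  d = ones (support m L)
  d≤c : d ≤ c
  d≤c = proj₁ (ones-support L L<m)
  1≤d : 1 ≤ d
  1≤d = ones-support-pos L L<m 1≤c
  d+j≤m : ∀ j → j ≤ m ∸ d → d ℕ.+ j ≤ m
  d+j≤m j j≤m∸d =
    ℕₚ.≤-trans (ℕₚ.+-monoʳ-≤ d j≤m∸d) (ℕₚ.≤-reflexive (ℕₚ.m+[n∸m]≡n (ones≤length (support m L))))

allB-cong : (xs : List A) {p q : A → Bool} → (∀ a → p a ≡ q a) → allB xs p ≡ allB xs q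
allB-cong []       p≗q = refl
allB-cong (x ∷ xs) p≗q = cong₂ _∧_ (p≗q x) (allB-cong xs p≗q)

allB-∧ : (xs : List A) (p q : A → Bool) → allB xs (λ a → p a ∧ q a) ≡ allB xs p ∧ allB xs q
allB-∧ []       p q = refl
allB-∧ (x ∷ xs) p q = trans (cong ((p x ∧ q x) ∧_) (allB-∧ xs p q))
  (∧.interchange (p x) (q x) (allB xs p) (allB xs q))

allB-map : (f : A → B) (xs : List A) (p : B → Bool) → allB (map f xs) p ≡ allB xs (p ∘ f)
allB-map f []       p = refl
allB-map f (x ∷ xs) p = cong (p (f x) ∧_) (allB-map f xs p)

allB-++ : (xs ys : List A) (p : A → Bool) → allB (xs ++ ys) p ≡ allB xs p ∧ allB ys p
allB-++ []       ys p = refl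
allB-++ (x ∷ xs) ys p = trans (cong (p x ∧_) (allB-++ xs ys p)) (sym (Boolₚ.∧-assoc (p x) _ _))

allB-tabulate : {n : ℕ} (g : Fin n → A) (p : A → Bool) → allB (tabulate g) p ≡ allB (allFin n) (p ∘ g)
allB-tabulate {n = zero}  g p = refl
allB-tabulate {n = suc n} g p =
  cong (p (g fzero) ∧_) (trans (allB-tabulate (g ∘ fsuc) p) (sym (allB-tabulate fsuc (p ∘ g))))

allB-allFin-intro : ∀ n (p : Fin n → Bool) → (∀ i → p i ≡ true) → allB (allFin n) p ≡ true
allB-allFin-intro zero    p p≡true = refl
allB-allFin-intro (suc n) p p≡true = cong₂ _∧_ (p≡true fzero)
  (trans (allB-tabulate fsuc p) (allB-allFin-intro n (p ∘ fsuc) (p≡true ∘ fsuc)))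

allB-allFin-elim : ∀ n (p : Fin n → Bool) → allB (allFin n) p ≡ true → ∀ i → p i ≡ true
allB-allFin-elim (suc n) p all≡true fzero    = proj₁ (∧-true all≡true)
allB-allFin-elim (suc n) p all≡true (fsuc i) =
  allB-allFin-elim n (p ∘ fsuc) (trans (sym (allB-tabulate fsuc p)) (proj₂ (∧-true {p fzero} all≡true))) i

-- The shape of the conditions in `placements` and `injectiveᵇ`, which therefore unfold to it.
pairwiseᵇ : (n : ℕ) → (Fin n → Fin n → Bool) → Bool
pairwiseᵇ n R = allB (allFin n) λ i → allB (allFin n) λ i' → (toℕ i ≡ᵇ toℕ i') ∨ R i i'

pairwiseᵇ-cong : ∀ n {R S : Fin n → Fin n → Bool} → (∀ i i' → R i i' ≡ S i i') → pairwiseᵇ n R ≡ pairwiseᵇ n S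
pairwiseᵇ-cong n R≗S =
  allB-cong (allFin n) (λ i → allB-cong (allFin n) (λ i' → cong ((toℕ i ≡ᵇ toℕ i') ∨_) (R≗S i i')))

pairwiseᵇ-∧ : ∀ n (R S : Fin n → Fin n → Bool) →
  pairwiseᵇ n (λ i i' → R i i' ∧ S i i') ≡ pairwiseᵇ n R ∧ pairwiseᵇ n S
pairwiseᵇ-∧ n R S = trans
  (allB-cong (allFin n) (λ i → trans
    (allB-cong (allFin n) (λ i' → Boolₚ.∨-distribˡ-∧ (toℕ i ≡ᵇ toℕ i') _ _))
    (allB-∧ (allFin n) _ _)))
  (allB-∧ (allFin n) _ _)

pairwiseᵇ-suc : ∀ n (R : Fin (suc n) → Fin (suc n) → Bool) → pairwiseᵇ (suc n) R ≡
  allB (allFin n) (λ k → R fzero (fsuc k)) ∧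
  (allB (allFin n) (λ k → R (fsuc k) fzero) ∧ pairwiseᵇ n (λ k k' → R (fsuc k) (fsuc k')))
pairwiseᵇ-suc n R = cong₂ _∧_
  (allB-tabulate fsuc (λ i' → (0 ≡ᵇ toℕ i') ∨ R fzero i'))
  (trans (allB-tabulate fsuc (λ i → allB (allFin (suc n)) (λ i' → (toℕ i ≡ᵇ toℕ i') ∨ R i i')))
    (trans (allB-cong (allFin n) (λ k → cong (R (fsuc k) fzero ∧_)
                (allB-tabulate fsuc (λ i' → (suc (toℕ k) ≡ᵇ toℕ i') ∨ R (fsuc k) i'))))
           (allB-∧ (allFin n) (λ k → R (fsuc k) fzero)
                   (λ k → allB (allFin n) (λ k' → (toℕ k ≡ᵇ toℕ k') ∨ R (fsuc k) (fsuc k'))))))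

∉ᵇ-tabulate : ∀ {n} x (g : Fin n → ℕ) → not (x ∈ᵇ tabulate g) ≡ allB (allFin n) (λ i → not (x ≡ᵇ g i))
∉ᵇ-tabulate {zero}  x g = refl
∉ᵇ-tabulate {suc n} x g = trans (not-∨ (x ≡ᵇ g fzero) _)
  (cong (not (x ≡ᵇ g fzero) ∧_)
    (trans (∉ᵇ-tabulate x (g ∘ fsuc)) (sym (allB-tabulate fsuc (λ i → not (x ≡ᵇ g i))))))
  where
  not-∨ : ∀ a b → not (a ∨ b) ≡ not a ∧ not b
  not-∨ true  b = refl
  not-∨ false b = refl

distinctᵇ-tabulate : ∀ n (h : Fin n → ℕ) → distinctᵇ (tabulate h) ≡ pairwiseᵇ n (λ i i' → not (h i ≡ᵇ h i'))
distinctᵇ-tabulate zero    h = refl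
distinctᵇ-tabulate (suc n) h = begin
  not (h fzero ∈ᵇ tabulate (h ∘ fsuc)) ∧ distinctᵇ (tabulate (h ∘ fsuc))
    ≡⟨ cong₂ _∧_ (∉ᵇ-tabulate (h fzero) (h ∘ fsuc)) (distinctᵇ-tabulate n (h ∘ fsuc)) ⟩
  fresh ∧ rest
    ≡⟨ cong (_∧ rest) (sym (Boolₚ.∧-idem fresh)) ⟩
  (fresh ∧ fresh) ∧ rest
    ≡⟨ Boolₚ.∧-assoc fresh fresh rest ⟩
  fresh ∧ (fresh ∧ rest)
    ≡⟨ cong (λ z → fresh ∧ (z ∧ rest)) (allB-cong (allFin n) (λ k → cong not (≡ᵇ-sym (h fzero) (h (fsuc k))))) ⟩
  fresh ∧ (allB (allFin n) (λ k → not (h (fsuc k) ≡ᵇ h fzero)) ∧ rest)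
    ≡⟨ sym (pairwiseᵇ-suc n (λ i i' → not (h i ≡ᵇ h i'))) ⟩
  pairwiseᵇ (suc n) (λ i i' → not (h i ≡ᵇ h i')) ∎
  where
  open ≡-Reasoning
  fresh rest : Bool
  fresh = allB (allFin n) (λ k → not (h fzero ≡ᵇ h (fsuc k)))
  rest  = pairwiseᵇ n (λ k k' → not (h (fsuc k) ≡ᵇ h (fsuc k')))

distinctᵇ-map : ∀ n (h : Fin n → ℕ) → distinctᵇ (map h (allFin n)) ≡ pairwiseᵇ n (λ i i' → not (h i ≡ᵇ h i'))
distinctᵇ-map n h = trans (cong distinctᵇ (Listₚ.map-tabulate (λ i → i) h)) (distinctᵇ-tabulate n h)

∈ᵇ-++ : ∀ x (L M : List ℕ) → x ∈ᵇ (L ++ M) ≡ (x ∈ᵇ L) ∨ (x ∈ᵇ M)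
∈ᵇ-++ x []      M = refl
∈ᵇ-++ x (y ∷ L) M = trans (cong ((x ≡ᵇ y) ∨_) (∈ᵇ-++ x L M)) (sym (Boolₚ.∨-assoc (x ≡ᵇ y) _ _))

∉ᵇ-above : ∀ x K (M : List ℕ) → x < K → All (K ≤_) M → x ∈ᵇ M ≡ false
∉ᵇ-above x K []      x<K []          = refl
∉ᵇ-above x K (y ∷ M) x<K (K≤y ∷ K≤M) with x ≡ᵇ y in x≡ᵇy
... | true  = contradiction (ℕₚ.<-≤-trans x<K K≤y) (ℕₚ.<-irrefl (≡ᵇ-true⇒≡ x y x≡ᵇy))
... | false = ∉ᵇ-above x K M x<K K≤M

distinctᵇ-++ : ∀ K (L M : List ℕ) → All (_< K) L → All (K ≤_) M → distinctᵇ (L ++ M) ≡ distinctᵇ L ∧ distinctᵇ M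
distinctᵇ-++ K []      M _            _   = refl
distinctᵇ-++ K (x ∷ L) M (x<K ∷ L<K) K≤M = begin
  not (x ∈ᵇ (L ++ M)) ∧ distinctᵇ (L ++ M)
    ≡⟨ cong₂ (λ u z → not u ∧ z) (trans (∈ᵇ-++ x L M) (cong ((x ∈ᵇ L) ∨_) (∉ᵇ-above x K M x<K K≤M)))
                                 (distinctᵇ-++ K L M L<K K≤M) ⟩
  not ((x ∈ᵇ L) ∨ false) ∧ (distinctᵇ L ∧ distinctᵇ M)
    ≡⟨ cong (λ u → not u ∧ (distinctᵇ L ∧ distinctᵇ M)) (Boolₚ.∨-identityʳ (x ∈ᵇ L)) ⟩
  not (x ∈ᵇ L) ∧ (distinctᵇ L ∧ distinctᵇ M)
    ≡⟨ sym (Boolₚ.∧-assoc (not (x ∈ᵇ L)) _ _) ⟩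
  (not (x ∈ᵇ L) ∧ distinctᵇ L) ∧ distinctᵇ M ∎
  where open ≡-Reasoning

-- Permanents and placements

bit-∧ : ∀ a b → bit a ℕ.* bit b ≡ bit (a ∧ b)
bit-∧ true  true  = refl
bit-∧ true  false = refl
bit-∧ false b     = refl

∏-bit : (xs : List A) (p : A → Bool) → ℕprod (map (λ a → bit (p a)) xs) ≡ bit (allB xs p)
∏-bit []       p = refl
∏-bit (x ∷ xs) p = trans (cong (bit (p x) ℕ.*_) (∏-bit xs p)) (bit-∧ (p x) (allB xs p))

∏-* : (xs : List A) (f g : A → ℕ) →
  ℕprod (map (λ a → f a ℕ.* g a) xs) ≡ ℕprod (map f xs) ℕ.* ℕprod (map g xs)
∏-* []       f g = refl
∏-* (x ∷ xs) f g = trans (cong (f x ℕ.* g x ℕ.*_) (∏-* xs f g))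
  (ℕ*.interchange (f x) (g x) (ℕprod (map f xs)) (ℕprod (map g xs)))

∏-nth : {m : ℕ} (s : Vec Bool m) (xs : List A) (x : A → ℕ) →
  ℕprod (map (λ a → bit (nth s (x a))) xs) ≡ bit (allB (map x xs) (nth s))
∏-nth s xs x = trans (∏-bit xs (nth s ∘ x)) (cong bit (sym (allB-map x xs (nth s))))

∏-nth² : {m : ℕ} (s : Vec Bool m) (xs : List A) (x y : A → ℕ) →
  ℕprod (map (λ a → bit (nth s (x a)) ℕ.* bit (nth s (y a))) xs) ≡ bit (allB (map x xs ++ map y xs) (nth s))
∏-nth² s xs x y = begin
  ℕprod (map (λ a → bit (nth s (x a)) ℕ.* bit (nth s (y a))) xs)
    ≡⟨ ∏-* xs _ _ ⟩
  ℕprod (map (λ a → bit (nth s (x a))) xs) ℕ.* ℕprod (map (λ a → bit (nth s (y a))) xs)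
    ≡⟨ cong₂ ℕ._*_ (∏-nth s xs x) (∏-nth s xs y) ⟩
  bit (allB (map x xs) (nth s)) ℕ.* bit (allB (map y xs) (nth s))
    ≡⟨ bit-∧ (allB (map x xs) (nth s)) _ ⟩
  bit (allB (map x xs) (nth s) ∧ allB (map y xs) (nth s))
    ≡⟨ cong bit (sym (allB-++ (map x xs) _ (nth s))) ⟩
  bit (allB (map x xs ++ map y xs) (nth s)) ∎
  where open ≡-Reasoning

diagonalProduct : {n : ℕ} → Vec (Fin n) n → Mat n → ℕ
diagonalProduct {n} σ A = ℕprod (map (λ i → A i (lookup σ i)) (allFin n))

if-bit : (w : ℤ) (b : Bool) → w * + bit b ≡ (if b then w else + 0)
if-bit w true  = ℤₚ.*-identityʳ w
if-bit w false = ℤₚ.*-zeroʳ w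

∑-weighted-per : ∀ {n} m c (A : Vec Bool m → Mat n) (vars : Vec (Fin n) n → List ℕ) (W : ℕ → ℤ) →
  (∀ σ s → diagonalProduct σ (A s) ≡ bit (allB (vars σ) (nth s))) →
  (∀ σ → All (_< m) (vars σ)) → (∀ σ → length (vars σ) ≡ c) → 1 ≤ c →
  (∀ k → 1 ≤ k → k ≤ m → W k ≡ exactWeight m c k) →
  ∑[ s ∈ vecsOf bools m ] W (ones s) * + per (A s) ≡ ∑[ σ ∈ perms n ] + bit (distinctᵇ (vars σ))
∑-weighted-per {n} m c A vars W term≡ vars<m length≡ 1≤c W≡ = begin
  ∑[ s ∈ vecsOf bools m ] W (ones s) * + per (A s)
    ≡⟨ ∑-cong (vecsOf bools m) (λ s → trans (cong (W (ones s) *_) (+sum≡∑ (λ σ → diagonalProduct σ (A s)) (perms n)))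
                                            (∑-*ˡ (W (ones s)) (perms n) _)) ⟩
  ∑[ s ∈ vecsOf bools m ] ∑[ σ ∈ perms n ] W (ones s) * + diagonalProduct σ (A s)
    ≡⟨ ∑-swap (vecsOf bools m) (perms n) _ ⟩
  ∑[ σ ∈ perms n ] ∑[ s ∈ vecsOf bools m ] W (ones s) * + diagonalProduct σ (A s)
    ≡⟨ ∑-cong (perms n) (λ σ → trans
         (∑-cong (vecsOf bools m) (λ s → trans (cong (λ t → W (ones s) * + t) (term≡ σ s)) (if-bit (W (ones s)) _)))
         (∑-exactWeight-containing m c (vars σ) W (vars<m σ) (length≡ σ) 1≤c W≡)) ⟩
  ∑[ σ ∈ perms n ] + bit (distinctᵇ (vars σ)) ∎
  where open ≡-Reasoning

onSquares : {n : ℕ} → Vec (Fin n) n → ((i j i' j' : ℕ) → Bool) → Fin n → Fin n → Bool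
onSquares σ ok i i' = ok (idx i) (idx (lookup σ i)) (idx i') (idx (lookup σ i'))

placements≡∑-distinct : ∀ n (ok : (i j i' j' : ℕ) → Bool) (vars : Vec (Fin n) n → List ℕ) →
  (∀ σ → pairwiseᵇ n (onSquares σ ok) ≡ distinctᵇ (vars σ)) →
  + placements n (λ i j i' j' → colNe i j i' j' ∧ ok i j i' j') ≡ ∑[ σ ∈ perms n ] + bit (distinctᵇ (vars σ))
placements≡∑-distinct n ok vars ok≡ = begin
  + placements n (λ i j i' j' → colNe i j i' j' ∧ ok i j i' j')
    ≡⟨ +countB≡∑ (vecsOf (allFin n) n) _ ⟩
  ∑[ σ ∈ vecsOf (allFin n) n ] + bit (pairwiseᵇ n (λ i i' → onSquares σ colNe i i' ∧ onSquares σ ok i i'))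
    ≡⟨ ∑-cong (vecsOf (allFin n) n) (λ σ → cong (λ b → + bit b)
         (trans (pairwiseᵇ-∧ n (onSquares σ colNe) (onSquares σ ok)) (cong (injectiveᵇ σ ∧_) (ok≡ σ)))) ⟩
  ∑[ σ ∈ vecsOf (allFin n) n ] + bit (injectiveᵇ σ ∧ distinctᵇ (vars σ))
    ≡⟨ ∑-cong (vecsOf (allFin n) n) (λ σ → bit-if (injectiveᵇ σ) _) ⟩
  ∑[ σ ∈ vecsOf (allFin n) n ] (if injectiveᵇ σ then + bit (distinctᵇ (vars σ)) else + 0)
    ≡⟨ sym (∑-filter injectiveᵇ (vecsOf (allFin n) n) _) ⟩
  ∑[ σ ∈ perms n ] + bit (distinctᵇ (vars σ)) ∎
  where
  open ≡-Reasoning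
  bit-if : ∀ a b → + bit (a ∧ b) ≡ (if a then + bit b else + 0)
  bit-if true  b = refl
  bit-if false b = refl

inRangeᵇ : ℕ → ℕ → Bool
inRangeᵇ zero          K       = false
inRangeᵇ (suc k)       zero    = false
inRangeᵇ (suc zero)    (suc K) = true
inRangeᵇ (suc (suc k)) (suc K) = inRangeᵇ (suc k) K

inRangeᵇ-true : ∀ k K → 1 ≤ k → k ≤ K → inRangeᵇ k K ≡ true
inRangeᵇ-true (suc zero)    (suc K) _ _         = refl
inRangeᵇ-true (suc (suc k)) (suc K) _ (s≤s k≤K) = inRangeᵇ-true (suc k) K (s≤s z≤n) k≤K

inRangeᵇ-false : ∀ k K → K < k → inRangeᵇ k K ≡ false
inRangeᵇ-false (suc k)       zero    _         = refl
inRangeᵇ-false (suc (suc k)) (suc K) (s≤s K<k) = inRangeᵇ-false (suc k) K K<k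

∑-upTo-suc : ∀ K (h : ℕ → ℤ) → ∑ (upTo (suc K)) h ≡ h 0 + ∑ (upTo K) (h ∘ suc)
∑-upTo-suc K h = cong (_+_ (h 0)) (cong sumℤ
  (trans (Listₚ.map-applyUpTo suc h K) (sym (Listₚ.map-applyUpTo (λ x → x) (h ∘ suc) K))))

∑-upTo-indicator : ∀ K c (f : ℕ → ℤ) →
  ∑[ k ∈ upTo K ] (if c ≡ᵇ suc k then f (suc k) else + 0) ≡ (if inRangeᵇ c K then f c else + 0)
∑-upTo-indicator zero    zero          f = refl
∑-upTo-indicator zero    (suc c)       f = refl
∑-upTo-indicator (suc K) zero          f = trans
  (∑-upTo-suc K (λ k → if 0 ≡ᵇ suc k then f (suc k) else + 0))
  (trans (ℤₚ.+-identityˡ _) (∑-zero (upTo K)))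
∑-upTo-indicator (suc K) (suc zero)    f = trans
  (∑-upTo-suc K (λ k → if 1 ≡ᵇ suc k then f (suc k) else + 0))
  (trans (cong (_+_ (f 1)) (∑-upTo-indicator K 0 (f ∘ suc))) (ℤₚ.+-identityʳ (f 1)))
∑-upTo-indicator (suc K) (suc (suc c)) f = trans
  (∑-upTo-suc K (λ k → if suc (suc c) ≡ᵇ suc k then f (suc k) else + 0))
  (trans (ℤₚ.+-identityˡ _) (∑-upTo-indicator K (suc c) (f ∘ suc)))

countB-ones : {m : ℕ} (s : Vec Bool m) → countB (Vec.toList s) (λ b → b) ≡ ones s
countB-ones []          = refl
countB-ones (true ∷ s)  = cong suc (countB-ones s)
countB-ones (false ∷ s) = countB-ones s

restrictTo : ℕ → (ℕ → ℤ) → ℕ → ℤ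
restrictTo K ω k = if inRangeᵇ k K then ω k else + 0

sumFrom1-Smk : ∀ m K (ω : ℕ → ℤ) (F : Vec Bool m → ℤ) →
  sumFrom1 K (λ i → ω i * ∑ (Smk m i) F) ≡ ∑[ s ∈ vecsOf bools m ] restrictTo K ω (ones s) * F s
sumFrom1-Smk m K ω F = begin
  ∑[ k ∈ upTo K ] ω (suc k) * ∑ (Smk m (suc k)) F
    ≡⟨ ∑-cong (upTo K) (λ k → cong (ω (suc k) *_) (trans (∑-filter _ (vecsOf bools m) F)
         (∑-cong (vecsOf bools m) (λ s → cong (λ z → if z ≡ᵇ suc k then F s else + 0) (countB-ones s))))) ⟩
  ∑[ k ∈ upTo K ] ω (suc k) * ∑ (vecsOf bools m) (λ s → if ones s ≡ᵇ suc k then F s else + 0)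
    ≡⟨ ∑-cong (upTo K) (λ k → trans (∑-*ˡ (ω (suc k)) (vecsOf bools m) _)
         (∑-cong (vecsOf bools m) (λ s → *-if (ones s ≡ᵇ suc k) (ω (suc k)) (F s)))) ⟩
  ∑[ k ∈ upTo K ] ∑ (vecsOf bools m) (λ s → if ones s ≡ᵇ suc k then ω (suc k) * F s else + 0)
    ≡⟨ ∑-swap (upTo K) (vecsOf bools m) _ ⟩
  ∑[ s ∈ vecsOf bools m ] ∑ (upTo K) (λ k → if ones s ≡ᵇ suc k then ω (suc k) * F s else + 0)
    ≡⟨ ∑-cong (vecsOf bools m) (λ s → trans (∑-upTo-indicator K (ones s) (λ j → ω j * F s))
                                            (if-* (inRangeᵇ (ones s) K) (ω (ones s)) (F s))) ⟩
  ∑[ s ∈ vecsOf bools m ] restrictTo K ω (ones s) * F s ∎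
  where
  open ≡-Reasoning
  *-if : ∀ b (x y : ℤ) → x * (if b then y else + 0) ≡ (if b then x * y else + 0)
  *-if true  x y = refl
  *-if false x y = ℤₚ.*-zeroʳ x
  if-* : ∀ b (x y : ℤ) → (if b then x * y else + 0) ≡ (if b then x else + 0) * y
  if-* true  x y = refl
  if-* false x y = refl

pos-∸ : ∀ m n → n ≤ m → + (m ∸ n) ≡ + m - + n
pos-∸ m n n≤m = trans (sym (ℤₚ.⊖-≥ n≤m)) (sym (ℤₚ.m-n≡m⊖n m n))

∸-∸-comm : ∀ m a b → m ∸ a ∸ b ≡ m ∸ b ∸ a
∸-∸-comm m a b = trans (ℕₚ.∸-+-assoc m a b) (trans (cong (m ∸_) (ℕₚ.+-comm a b)) (sym (ℕₚ.∸-+-assoc m b a)))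

≤-from-+ : ∀ a b k → + a + + k ≡ + b → a ≤ b
≤-from-+ a b k a+k≡b =
  ℕₚ.≤-trans (ℕₚ.m≤m+n a k) (ℕₚ.≤-reflexive (ℤₚ.+-injective (trans (ℤₚ.pos-+ a k) a+k≡b)))

<-from-+ : ∀ a b k → + a + + 1 + + k ≡ + b → a < b
<-from-+ a b k a+1+k≡b =
  ≤-from-+ (suc a) b k (trans (cong (_+ + k) (trans (cong +_ (ℕₚ.+-comm 1 a)) (ℤₚ.pos-+ a 1))) a+1+k≡b)

≡-from-differences : ∀ a b c d → + a - + b ≡ + c - + d → a ≡ b → c ≡ d
≡-from-differences a b c d a-b≡c-d refl =
  ℤₚ.+-injective (ℤₚ.i-j≡0⇒i≡j (+ c) (+ d) (trans (sym a-b≡c-d) (ℤₚ.+-inverseʳ (+ a))))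

sgn-suc : ∀ k → sgn (suc k) ≡ - sgn k
sgn-suc k = ℤₚ.-1*i≡-i (sgn k)

sgn-double : ∀ t → sgn (t ℕ.+ t) ≡ + 1
sgn-double zero    = refl
sgn-double (suc t) = begin
  sgn (suc t ℕ.+ suc t)       ≡⟨ cong (sgn ∘ suc) (ℕₚ.+-suc t t) ⟩
  sgn (suc (suc (t ℕ.+ t)))   ≡⟨ trans (sgn-suc (suc (t ℕ.+ t))) (cong -_ (sgn-suc (t ℕ.+ t))) ⟩
  - - sgn (t ℕ.+ t)           ≡⟨ ℤₚ.neg-involutive _ ⟩
  sgn (t ℕ.+ t)               ≡⟨ sgn-double t ⟩
  + 1 ∎
  where open ≡-Reasoning

sgn-parity : ∀ k d t → k ℕ.+ d ≡ t ℕ.+ t → sgn k ≡ sgn d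
sgn-parity zero    d t d≡2t = sym (trans (cong sgn d≡2t) (sgn-double t))
sgn-parity (suc k) d t k+d≡2t = begin
  sgn (suc k)     ≡⟨ sgn-suc k ⟩
  - sgn k         ≡⟨ cong -_ (sgn-parity k (suc d) t (trans (ℕₚ.+-suc k d) k+d≡2t)) ⟩
  - sgn (suc d)   ≡⟨ cong -_ (sgn-suc d) ⟩
  - - sgn d       ≡⟨ ℤₚ.neg-involutive _ ⟩
  sgn d ∎
  where open ≡-Reasoning

module _ (d : ℕ) where

  %-cong-+ʳ : ∀ a b z → a % suc d ≡ b % suc d → (a ℕ.+ z) % suc d ≡ (b ℕ.+ z) % suc d
  %-cong-+ʳ a b z a≡b = begin
    (a ℕ.+ z) % suc d                 ≡⟨ %-distribˡ-+ a z (suc d) ⟩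
    (a % suc d ℕ.+ z % suc d) % suc d ≡⟨ cong (λ t → (t ℕ.+ z % suc d) % suc d) a≡b ⟩
    (b % suc d ℕ.+ z % suc d) % suc d ≡⟨ sym (%-distribˡ-+ b z (suc d)) ⟩
    (b ℕ.+ z) % suc d ∎
    where open ≡-Reasoning

  -- x ≡ x + a (d + 1) = (a + x) + a d  modulo d + 1.
  %-cancel-+ˡ : ∀ a x y → (a ℕ.+ x) % suc d ≡ (a ℕ.+ y) % suc d → x % suc d ≡ y % suc d
  %-cancel-+ˡ a x y a+x≡a+y = begin
    x % suc d                         ≡⟨ sym ([m+kn]%n≡m%n x a (suc d)) ⟩
    (x ℕ.+ a ℕ.* suc d) % suc d       ≡⟨ cong (_% suc d) (rearrange x) ⟩
    ((a ℕ.+ x) ℕ.+ a ℕ.* d) % suc d   ≡⟨ %-cong-+ʳ (a ℕ.+ x) (a ℕ.+ y) (a ℕ.* d) a+x≡a+y ⟩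
    ((a ℕ.+ y) ℕ.+ a ℕ.* d) % suc d   ≡⟨ cong (_% suc d) (sym (rearrange y)) ⟩
    (y ℕ.+ a ℕ.* suc d) % suc d       ≡⟨ [m+kn]%n≡m%n y a (suc d) ⟩
    y % suc d ∎
    where
    open ≡-Reasoning
    rearrange : ∀ t → t ℕ.+ a ℕ.* suc d ≡ (a ℕ.+ t) ℕ.+ a ℕ.* d
    rearrange t = begin
      t ℕ.+ a ℕ.* suc d      ≡⟨ cong (t ℕ.+_) (ℕₚ.*-suc a d) ⟩
      t ℕ.+ (a ℕ.+ a ℕ.* d)  ≡⟨ sym (ℕₚ.+-assoc t a _) ⟩
      (t ℕ.+ a) ℕ.+ a ℕ.* d  ≡⟨ cong (ℕ._+ a ℕ.* d) (ℕₚ.+-comm t a) ⟩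
      (a ℕ.+ t) ℕ.+ a ℕ.* d ∎

  ∸-%-reflect : ∀ K u u' → u ≤ K → u' ≤ K → (K ∸ u) % suc d ≡ (K ∸ u') % suc d → u % suc d ≡ u' % suc d
  ∸-%-reflect K u u' u≤K u'≤K K∸u≡K∸u' = %-cancel-+ˡ (K ∸ u) u u' (begin
    (K ∸ u ℕ.+ u) % suc d  ≡⟨ cong (_% suc d) (ℕₚ.m∸n+n≡m u≤K) ⟩
    K % suc d              ≡⟨ cong (_% suc d) (sym (ℕₚ.m∸n+n≡m u'≤K)) ⟩
    (K ∸ u' ℕ.+ u') % suc d ≡⟨ %-cong-+ʳ (K ∸ u') (K ∸ u) u' (sym K∸u≡K∸u') ⟩
    (K ∸ u ℕ.+ u') % suc d ∎)
    where open ≡-Reasoning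

  ∸-%-preserve : ∀ K u u' → u ≤ K → u' ≤ K → u % suc d ≡ u' % suc d → (K ∸ u) % suc d ≡ (K ∸ u') % suc d
  ∸-%-preserve K u u' u≤K u'≤K u≡u' = %-cancel-+ˡ u (K ∸ u) (K ∸ u') (begin
    (u ℕ.+ (K ∸ u)) % suc d   ≡⟨ cong (_% suc d) (ℕₚ.m+[n∸m]≡n u≤K) ⟩
    K % suc d                 ≡⟨ cong (_% suc d) (sym (ℕₚ.m+[n∸m]≡n u'≤K)) ⟩
    (u' ℕ.+ (K ∸ u')) % suc d ≡⟨ %-cong-+ʳ u' u (K ∸ u') (sym u≡u') ⟩
    (u ℕ.+ (K ∸ u')) % suc d ∎)
    where open ≡-Reasoning

toℕ-mod : ∀ k n → k < suc n → toℕ (k mod suc n) ≡ k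
toℕ-mod k n k<n = trans (Finₚ.toℕ-fromℕ< (m%n<n k (suc n))) (m<n⇒m%n≡m k<n)

idx-step : ∀ {n} (i i' : Fin n) → idx i' ≡ idx i ℕ.+ 1 → toℕ i' ≡ suc (toℕ i)
idx-step i i' e = ℕₚ.suc-injective (trans e (ℕₚ.+-comm (idx i) 1))

All-map-allFin : ∀ n (P : ℕ → Set) (f : Fin n → ℕ) → (∀ i → P (f i)) → All P (map f (allFin n))
All-map-allFin n P f Pf = Allₚ.map⁺ (All.universal Pf (allFin n))

length-map-allFin : ∀ n (f : Fin n → ℕ) → length (map f (allFin n)) ≡ n
length-map-allFin n f = trans (Listₚ.length-map f (allFin n)) (Listₚ.length-tabulate (λ i → i))

length-map-allFin² : ∀ n (f g : Fin n → ℕ) → length (map f (allFin n) ++ map g (allFin n)) ≡ 2 ℕ.* n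
length-map-allFin² n f g = begin
  length (map f (allFin n) ++ map g (allFin n))           ≡⟨ Listₚ.length-++ (map f (allFin n)) ⟩
  length (map f (allFin n)) ℕ.+ length (map g (allFin n)) ≡⟨ cong₂ ℕ._+_ (length-map-allFin n f) (length-map-allFin n g) ⟩
  n ℕ.+ n                                                 ≡⟨ cong (n ℕ.+_) (sym (ℕₚ.+-identityʳ n)) ⟩
  2 ℕ.* n ∎
  where open ≡-Reasoning

-- Every element of A occurs exactly once in xs.
Enumerates : {A : Set} → DecidableEquality A → List A → Set
Enumerates {A} _≟_ xs = ∀ (y : A) (f : A → ℤ) → ∑[ x ∈ xs ] (if does (x ≟ y) then f x else + 0) ≡ f y

enumerates-bools : Enumerates Boolₚ._≟_ bools
enumerates-bools true  f = trans (ℤₚ.+-identityˡ _) (ℤₚ.+-identityʳ (f true))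
enumerates-bools false f = ℤₚ.+-identityʳ (f false)

enumerates-vecsOf : {A : Set} (_≟_ : DecidableEquality A) (xs : List A) → Enumerates _≟_ xs →
  ∀ m → Enumerates (Vecₚ.≡-dec _≟_) (vecsOf xs m)
enumerates-vecsOf _≟_ xs enum zero    []      f = ℤₚ.+-identityʳ (f [])
enumerates-vecsOf {A} _≟_ xs enum (suc m) (y ∷ w) f = begin
  ∑ (vecsOf xs (suc m)) F
    ≡⟨ ∑-vecsOf-suc xs m F ⟩
  ∑[ x ∈ xs ] ∑ (vecsOf xs m) (λ v → F (x ∷ v))
    ≡⟨ ∑-cong xs column ⟩
  ∑[ x ∈ xs ] (if does (x ≟ y) then f (x ∷ w) else + 0)
    ≡⟨ enum y (λ x → f (x ∷ w)) ⟩
  f (y ∷ w) ∎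
  where
  open ≡-Reasoning
  F : Vec A (suc m) → ℤ
  F v = if does (Vecₚ.≡-dec _≟_ v (y ∷ w)) then f v else + 0
  column : ∀ x → ∑ (vecsOf xs m) (λ v → F (x ∷ v)) ≡ (if does (x ≟ y) then f (x ∷ w) else + 0)
  column x with x ≟ y
  ... | yes refl = enumerates-vecsOf _≟_ xs enum m w (λ v → f (x ∷ v))
  ... | no _     = ∑-zero (vecsOf xs m)

∑-filter-bijection : {X D : Set} (_≟ˣ_ : DecidableEquality X) (_≟ᵈ_ : DecidableEquality D)
  (xs : List X) (ds : List D) → Enumerates _≟ˣ_ xs → Enumerates _≟ᵈ_ ds →
  (P : X → Bool) (φ : D → X) (ψ : X → D) →
  (∀ d → P (φ d) ≡ true) → (∀ x → P x ≡ true → φ (ψ x) ≡ x) → (∀ d → ψ (φ d) ≡ d) →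
  (g : X → ℤ) → ∑ (filterᵇ P xs) g ≡ ∑ ds (g ∘ φ)
∑-filter-bijection _≟ˣ_ _≟ᵈ_ xs ds enumX enumD P φ ψ Pφ φψ ψφ g = begin
  ∑ (filterᵇ P xs) g
    ≡⟨ ∑-filter P xs g ⟩
  ∑[ x ∈ xs ] (if P x then g x else + 0)
    ≡⟨ ∑-cong xs (λ x → sym (fibre x)) ⟩
  ∑[ x ∈ xs ] ∑ ds (λ d → if does (x ≟ˣ φ d) then g x else + 0)
    ≡⟨ ∑-swap xs ds _ ⟩
  ∑[ d ∈ ds ] ∑ xs (λ x → if does (x ≟ˣ φ d) then g x else + 0)
    ≡⟨ ∑-cong ds (λ d → enumX (φ d) g) ⟩
  ∑ ds (g ∘ φ) ∎
  where
  open ≡-Reasoning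
  true≢false : true ≢ false
  true≢false ()
  fibre : ∀ x → ∑[ d ∈ ds ] (if does (x ≟ˣ φ d) then g x else + 0) ≡ (if P x then g x else + 0)
  fibre x with P x in Px
  ... | true = trans
    (∑-cong ds (λ d → cong (λ b → if b then g x else + 0) (does-⇔
      (mk⇔ (λ x≡φd → trans (sym (ψφ d)) (cong ψ (sym x≡φd))) (λ d≡ψx → trans (sym (φψ x Px)) (cong φ (sym d≡ψx))))
      (x ≟ˣ φ d) (d ≟ᵈ ψ x))))
    (enumD (ψ x) (λ _ → g x))
  ... | false = trans
    (∑-cong ds (λ d → cong (λ b → if b then g x else + 0)
      (dec-false (x ≟ˣ φ d) (λ x≡φd → true≢false (trans (sym (Pφ d)) (trans (cong P (sym x≡φd)) Px))))))
    (∑-zero ds)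

nth-lookup : {m : ℕ} (d : Vec Bool m) (k : Fin m) → nth d (toℕ k) ≡ lookup d k
nth-lookup (b ∷ d) fzero    = refl
nth-lookup (b ∷ d) (fsuc k) = nth-lookup d k

nth-fromℕ< : {m : ℕ} (d : Vec Bool m) (k : ℕ) (k<m : k < m) → nth d k ≡ lookup d (fromℕ< k<m)
nth-fromℕ< d k k<m = trans (cong (nth d) (sym (Finₚ.toℕ-fromℕ< k<m))) (nth-lookup d (fromℕ< k<m))

vec-ext : {m : ℕ} (u v : Vec A m) → (∀ k → lookup u k ≡ lookup v k) → u ≡ v
vec-ext u v u≗v = trans (sym (Vecₚ.tabulate∘lookup u)) (trans (Vecₚ.tabulate-cong u≗v) (Vecₚ.tabulate∘lookup v))

bmat-ext : {n : ℕ} (M N : BMat n) → (∀ i j → entry M i j ≡ entry N i j) → M ≡ N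
bmat-ext M N M≗N = vec-ext M N (λ i → vec-ext (lookup M i) (lookup N i) (M≗N i))

entry-tabulate : {n : ℕ} (F : Fin n → Fin n → Bool) (i j : Fin n) →
  entry (Vec.tabulate (λ i → Vec.tabulate (F i))) i j ≡ F i j
entry-tabulate F i j = trans (cong (λ r → lookup r j) (Vecₚ.lookup∘tabulate (λ i → Vec.tabulate (F i)) i))
                             (Vecₚ.lookup∘tabulate (F i) j)

countB-applyUpTo : {m : ℕ} (d : Vec Bool m) (f : ℕ → ℕ) (p : ℕ → Bool) → (∀ k → k < m → p (f k) ≡ nth d k) →
  countB (List.applyUpTo f m) p ≡ ones d
countB-applyUpTo []      f p p≡d = refl
countB-applyUpTo (b ∷ d) f p p≡d with p (f 0) | p≡d 0 (s≤s z≤n)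
... | true  | refl = cong suc (countB-applyUpTo d (f ∘ suc) p (λ k k<m → p≡d (suc k) (s≤s k<m)))
... | false | refl = countB-applyUpTo d (f ∘ suc) p (λ k k<m → p≡d (suc k) (s≤s k<m))

module Queens (n : ℕ) (1≤n : 1 ≤ n) where

  -- Positions in s of the variables x_{n-i+j} and y_{2n-i-j+1} of the (i, j) entry of Q_n.
  xVar yVar : Fin n → Fin n → ℕ
  xVar i j = (n ∸ idx i ℕ.+ idx j) ∸ 1
  yVar i j = (2 ℕ.* n ∸ 1) ℕ.+ ((2 ℕ.* n ∸ idx i ∸ idx j ℕ.+ 1) ∸ 1)

  vars : Vec (Fin n) n → List ℕ
  vars σ = map (λ i → xVar i (lookup σ i)) (allFin n) ++ map (λ i → yVar i (lookup σ i)) (allFin n)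

  2n≡ : + (2 ℕ.* n) ≡ + n + + n
  2n≡ = trans (cong +_ (cong (n ℕ.+_) (ℕₚ.+-identityʳ n))) (ℤₚ.pos-+ n n)

  2n-1≡ : + (2 ℕ.* n ∸ 1) ≡ + n + + n - + 1
  2n-1≡ = trans (pos-∸ (2 ℕ.* n) 1 (ℕₚ.≤-trans 1≤n (ℕₚ.m≤m+n n (n ℕ.+ 0)))) (cong (_- + 1) 2n≡)

  4n-2≡ : + (4 ℕ.* n ∸ 2) ≡ + n + + n + + n + + n - + 2
  4n-2≡ = trans (pos-∸ (4 ℕ.* n) 2 (ℕₚ.≤-trans (ℕₚ.*-monoʳ-≤ 2 1≤n) (ℕₚ.*-monoˡ-≤ n {2} {4} (s≤s (s≤s z≤n)))))
    (cong (_- + 2) (trans (ℤₚ.pos-* 4 n) (solve 1 (λ x → con (+ 4) :* x := x :+ x :+ x :+ x) refl (+ n))))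

  idx+idx≤2n : ∀ (i j : Fin n) → idx i ℕ.+ idx j ≤ 2 ℕ.* n
  idx+idx≤2n i j = ℕₚ.≤-trans (ℕₚ.+-mono-≤ (Finₚ.toℕ<n i) (Finₚ.toℕ<n j))
    (ℕₚ.≤-reflexive (cong (n ℕ.+_) (sym (ℕₚ.+-identityʳ n))))

  xVar-ℤ : ∀ i j → + xVar i j ≡ + n - + idx i + + idx j - + 1
  xVar-ℤ i j = trans (pos-∸ _ 1 (ℕₚ.≤-trans (s≤s z≤n) (ℕₚ.m≤n+m (idx j) (n ∸ idx i))))
    (cong (_- + 1) (trans (ℤₚ.pos-+ (n ∸ idx i) (idx j)) (cong (_+ + idx j) (pos-∸ n (idx i) (Finₚ.toℕ<n i)))))

  yVar-ℤ : ∀ i j → + yVar i j ≡ (+ n + + n - + 1) + (+ n + + n - + idx i - + idx j)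
  yVar-ℤ i j = trans (ℤₚ.pos-+ (2 ℕ.* n ∸ 1) _) (cong₂ _+_ 2n-1≡ (begin
    + ((2 ℕ.* n ∸ idx i ∸ idx j ℕ.+ 1) ∸ 1) ≡⟨ cong +_ (ℕₚ.m+n∸n≡m (2 ℕ.* n ∸ idx i ∸ idx j) 1) ⟩
    + (2 ℕ.* n ∸ idx i ∸ idx j)            ≡⟨ cong +_ (ℕₚ.∸-+-assoc (2 ℕ.* n) (idx i) (idx j)) ⟩
    + (2 ℕ.* n ∸ (idx i ℕ.+ idx j))        ≡⟨ pos-∸ (2 ℕ.* n) (idx i ℕ.+ idx j) (idx+idx≤2n i j) ⟩
    + (2 ℕ.* n) - + (idx i ℕ.+ idx j)      ≡⟨ cong₂ _-_ 2n≡ (ℤₚ.pos-+ (idx i) (idx j)) ⟩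
    + n + + n - (+ idx i + + idx j)        ≡⟨ solve 4 (λ a b i j → a :+ b :- (i :+ j) := a :+ b :- i :- j)
                                                 refl (+ n) (+ n) (+ idx i) (+ idx j) ⟩
    + n + + n - + idx i - + idx j ∎))
    where open ≡-Reasoning

  diffNe≡xVar≢ : ∀ i j i' j' → diffNe (idx i) (idx j) (idx i') (idx j') ≡ not (xVar i j ≡ᵇ xVar i' j')
  diffNe≡xVar≢ i j i' j' = cong not (≡ᵇ-⇔ a b c d
    (≡-from-differences a b c d difference≡) (≡-from-differences c d a b (sym difference≡)))
    where
    a b c d : ℕ
    a = idx j ℕ.+ idx i'
    b = idx j' ℕ.+ idx i
    c = xVar i j
    d = xVar i' j'
    difference≡ : + (idx j ℕ.+ idx i') - + (idx j' ℕ.+ idx i) ≡ + xVar i j - + xVar i' j'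
    difference≡ = begin
      + (idx j ℕ.+ idx i') - + (idx j' ℕ.+ idx i)
        ≡⟨ cong₂ _-_ (ℤₚ.pos-+ (idx j) (idx i')) (ℤₚ.pos-+ (idx j') (idx i)) ⟩
      (+ idx j + + idx i') - (+ idx j' + + idx i)
        ≡⟨ solve 5 (λ N a b a' b' → (b :+ a') :- (b' :+ a) := (N :- a :+ b :- con (+ 1)) :- (N :- a' :+ b' :- con (+ 1)))
             refl (+ n) (+ idx i) (+ idx j) (+ idx i') (+ idx j') ⟩
      (+ n - + idx i + + idx j - + 1) - (+ n - + idx i' + + idx j' - + 1)
        ≡⟨ sym (cong₂ _-_ (xVar-ℤ i j) (xVar-ℤ i' j')) ⟩
      + xVar i j - + xVar i' j' ∎
      where open ≡-Reasoning

  sumNe≡yVar≢ : ∀ i j i' j' → sumNe (idx i) (idx j) (idx i') (idx j') ≡ not (yVar i j ≡ᵇ yVar i' j')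
  sumNe≡yVar≢ i j i' j' = cong not (≡ᵇ-⇔ a b c d
    (λ a≡b → ≡-from-differences b a c d (sym difference≡) (sym a≡b))
    (λ c≡d → sym (≡-from-differences c d b a difference≡ c≡d)))
    where
    a b c d : ℕ
    a = idx i ℕ.+ idx j
    b = idx i' ℕ.+ idx j'
    c = yVar i j
    d = yVar i' j'
    difference≡ : + yVar i j - + yVar i' j' ≡ + (idx i' ℕ.+ idx j') - + (idx i ℕ.+ idx j)
    difference≡ = begin
      + yVar i j - + yVar i' j'
        ≡⟨ cong₂ _-_ (yVar-ℤ i j) (yVar-ℤ i' j') ⟩
      ((+ n + + n - + 1) + (+ n + + n - + idx i - + idx j)) - ((+ n + + n - + 1) + (+ n + + n - + idx i' - + idx j'))
        ≡⟨ solve 5 (λ N a b a' b' → ((N :+ N :- con (+ 1)) :+ (N :+ N :- a :- b)) :- ((N :+ N :- con (+ 1)) :+ (N :+ N :- a' :- b'))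
                                     := (a' :+ b') :- (a :+ b)) refl (+ n) (+ idx i) (+ idx j) (+ idx i') (+ idx j') ⟩
      (+ idx i' + + idx j') - (+ idx i + + idx j)
        ≡⟨ sym (cong₂ _-_ (ℤₚ.pos-+ (idx i') (idx j')) (ℤₚ.pos-+ (idx i) (idx j))) ⟩
      + (idx i' ℕ.+ idx j') - + (idx i ℕ.+ idx j) ∎
      where open ≡-Reasoning

  xVar<2n-1 : ∀ i j → xVar i j < 2 ℕ.* n ∸ 1
  xVar<2n-1 i j = <-from-+ (xVar i j) (2 ℕ.* n ∸ 1) ((idx i ∸ 1) ℕ.+ (n ∸ idx j)) (begin
    + xVar i j + + 1 + + ((idx i ∸ 1) ℕ.+ (n ∸ idx j))
      ≡⟨ cong₂ (λ a b → a + + 1 + b) (xVar-ℤ i j)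
           (trans (ℤₚ.pos-+ (idx i ∸ 1) (n ∸ idx j))
                  (cong₂ _+_ (pos-∸ (idx i) 1 (s≤s z≤n)) (pos-∸ n (idx j) (Finₚ.toℕ<n j)))) ⟩
    (+ n - + idx i + + idx j - + 1) + + 1 + ((+ idx i - + 1) + (+ n - + idx j))
      ≡⟨ solve 3 (λ N a b → (N :- a :+ b :- con (+ 1)) :+ con (+ 1) :+ ((a :- con (+ 1)) :+ (N :- b)) := N :+ N :- con (+ 1))
           refl (+ n) (+ idx i) (+ idx j) ⟩
    + n + + n - + 1
      ≡⟨ sym 2n-1≡ ⟩
    + (2 ℕ.* n ∸ 1) ∎)
    where open ≡-Reasoning

  yVar<4n-2 : ∀ i j → yVar i j < 4 ℕ.* n ∸ 2
  yVar<4n-2 i j = <-from-+ (yVar i j) (4 ℕ.* n ∸ 2) ((idx i ∸ 1) ℕ.+ (idx j ∸ 1)) (begin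
    + yVar i j + + 1 + + ((idx i ∸ 1) ℕ.+ (idx j ∸ 1))
      ≡⟨ cong₂ (λ a b → a + + 1 + b) (yVar-ℤ i j)
           (trans (ℤₚ.pos-+ (idx i ∸ 1) (idx j ∸ 1)) (cong₂ _+_ (pos-∸ (idx i) 1 (s≤s z≤n)) (pos-∸ (idx j) 1 (s≤s z≤n)))) ⟩
    ((+ n + + n - + 1) + (+ n + + n - + idx i - + idx j)) + + 1 + ((+ idx i - + 1) + (+ idx j - + 1))
      ≡⟨ solve 3 (λ N a b → ((N :+ N :- con (+ 1)) :+ (N :+ N :- a :- b)) :+ con (+ 1) :+ ((a :- con (+ 1)) :+ (b :- con (+ 1)))
                             := N :+ N :+ N :+ N :- con (+ 2)) refl (+ n) (+ idx i) (+ idx j) ⟩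
    + n + + n + + n + + n - + 2
      ≡⟨ sym 4n-2≡ ⟩
    + (4 ℕ.* n ∸ 2) ∎)
    where open ≡-Reasoning

  vars<4n-2 : ∀ σ → All (_< 4 ℕ.* n ∸ 2) (vars σ)
  vars<4n-2 σ = Allₚ.++⁺
    (All-map-allFin n _ _ (λ i → ℕₚ.<-≤-trans (xVar<2n-1 i (lookup σ i))
                                 (ℕₚ.<⇒≤ (ℕₚ.≤-<-trans (ℕₚ.m≤m+n _ _) (yVar<4n-2 i (lookup σ i))))))
    (All-map-allFin n _ _ (λ i → yVar<4n-2 i (lookup σ i)))

  nonattacking≡distinct : ∀ σ →
    pairwiseᵇ n (onSquares σ (λ i j i' j' → diffNe i j i' j' ∧ sumNe i j i' j')) ≡ distinctᵇ (vars σ)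
  nonattacking≡distinct σ = begin
    pairwiseᵇ n (λ i i' → onSquares σ diffNe i i' ∧ onSquares σ sumNe i i')
      ≡⟨ pairwiseᵇ-∧ n (onSquares σ diffNe) (onSquares σ sumNe) ⟩
    pairwiseᵇ n (onSquares σ diffNe) ∧ pairwiseᵇ n (onSquares σ sumNe)
      ≡⟨ cong₂ _∧_ (pairwiseᵇ-cong n (λ i i' → diffNe≡xVar≢ i (lookup σ i) i' (lookup σ i')))
                   (pairwiseᵇ-cong n (λ i i' → sumNe≡yVar≢ i (lookup σ i) i' (lookup σ i'))) ⟩
    pairwiseᵇ n (λ i i' → not (x i ≡ᵇ x i')) ∧ pairwiseᵇ n (λ i i' → not (y i ≡ᵇ y i'))
      ≡⟨ sym (cong₂ _∧_ (distinctᵇ-map n x) (distinctᵇ-map n y)) ⟩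
    distinctᵇ (map x (allFin n)) ∧ distinctᵇ (map y (allFin n))
      ≡⟨ sym (distinctᵇ-++ (2 ℕ.* n ∸ 1) _ _ (All-map-allFin n _ x (λ i → xVar<2n-1 i (lookup σ i)))
                                              (All-map-allFin n _ y (λ i → ℕₚ.m≤m+n _ _))) ⟩
    distinctᵇ (vars σ) ∎
    where
    open ≡-Reasoning
    x y : Fin n → ℕ
    x i = xVar i (lookup σ i)
    y i = yVar i (lookup σ i)

  weight : ℕ → ℤ
  weight i = sgn i * + ((4 ℕ.* n ∸ i ∸ 2) C (2 ℕ.* n ∸ i))

  restrictTo-weight : ∀ k → 1 ≤ k → k ≤ 4 ℕ.* n ∸ 2 → restrictTo (2 ℕ.* n) weight k ≡ exactWeight (4 ℕ.* n ∸ 2) (2 ℕ.* n) k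
  restrictTo-weight k 1≤k _ with k ℕₚ.≤? 2 ℕ.* n
  ... | yes k≤2n = begin
    restrictTo (2 ℕ.* n) weight k
      ≡⟨ cong (λ b → if b then weight k else + 0) (inRangeᵇ-true k (2 ℕ.* n) 1≤k k≤2n) ⟩
    sgn k * + ((4 ℕ.* n ∸ k ∸ 2) C (2 ℕ.* n ∸ k))
      ≡⟨ cong₂ (λ a b → a * + (b C (2 ℕ.* n ∸ k)))
           (sgn-parity k (2 ℕ.* n ∸ k) n (trans (ℕₚ.m+[n∸m]≡n k≤2n) (cong (n ℕ.+_) (ℕₚ.+-identityʳ n))))
           (∸-∸-comm (4 ℕ.* n) k 2) ⟩
    sgn (2 ℕ.* n ∸ k) * + ((4 ℕ.* n ∸ 2 ∸ k) C (2 ℕ.* n ∸ k))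
      ≡⟨ sym (exactWeight-≤ (4 ℕ.* n ∸ 2) (2 ℕ.* n) k k≤2n) ⟩
    exactWeight (4 ℕ.* n ∸ 2) (2 ℕ.* n) k ∎
    where open ≡-Reasoning
  ... | no k≰2n = trans (cong (λ b → if b then weight k else + 0) (inRangeᵇ-false k (2 ℕ.* n) (ℕₚ.≰⇒> k≰2n)))
                        (sym (exactWeight-> (4 ℕ.* n ∸ 2) (2 ℕ.* n) k (ℕₚ.≰⇒> k≰2n)))

  Qc≡Qrhs : + Qc n ≡ Qrhs n
  Qc≡Qrhs = begin
    + Qc n
      ≡⟨ placements≡∑-distinct n (λ i j i' j' → diffNe i j i' j' ∧ sumNe i j i' j') vars nonattacking≡distinct ⟩
    ∑[ σ ∈ perms n ] + bit (distinctᵇ (vars σ))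
      ≡⟨ sym (∑-weighted-per (4 ℕ.* n ∸ 2) (2 ℕ.* n) (Qsub n) vars (restrictTo (2 ℕ.* n) weight)
               (λ σ s → ∏-nth² s (allFin n) (λ i → xVar i (lookup σ i)) (λ i → yVar i (lookup σ i)))
               vars<4n-2 (λ σ → length-map-allFin² n _ _) (ℕₚ.≤-trans 1≤n (ℕₚ.m≤m+n n (n ℕ.+ 0))) restrictTo-weight) ⟩
    ∑[ s ∈ vecsOf bools (4 ℕ.* n ∸ 2) ] restrictTo (2 ℕ.* n) weight (ones s) * + per (Qsub n s)
      ≡⟨ sym (sumFrom1-Smk (4 ℕ.* n ∸ 2) (2 ℕ.* n) weight (λ s → + per (Qsub n s))) ⟩
    sumFrom1 (2 ℕ.* n) (λ i → weight i * ∑ (Smk (4 ℕ.* n ∸ 2) i) (λ s → + per (Qsub n s)))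
      ≡⟨ ∑-cong (upTo (2 ℕ.* n)) (λ k → cong (weight (suc k) *_)
           (sym (+sum≡∑ (λ s → per (Qsub n s)) (Smk (4 ℕ.* n ∸ 2) (suc k))))) ⟩
    Qrhs n ∎
    where open ≡-Reasoning

module ToroidalQueens (n' : ℕ) where

  n : ℕ
  n = suc n'

  -- Positions in s of the variables x_{(n-i+j) mod n} and y_{(2n-i-j+1) mod n} of the (i, j) entry of T_n.
  xVar yVar : Fin n → Fin n → ℕ
  xVar i j = (n ∸ idx i ℕ.+ idx j) % n
  yVar i j = n ℕ.+ (2 ℕ.* n ∸ idx i ∸ idx j ℕ.+ 1) % n

  vars : Vec (Fin n) n → List ℕ
  vars σ = map (λ i → xVar i (lookup σ i)) (allFin n) ++ map (λ i → yVar i (lookup σ i)) (allFin n)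

  2n≡n+n : 2 ℕ.* n ≡ n ℕ.+ n
  2n≡n+n = cong (n ℕ.+_) (ℕₚ.+-identityʳ n)

  xVar<n : ∀ i j → xVar i j < n
  xVar<n i j = m%n<n (n ∸ idx i ℕ.+ idx j) n

  yVar<2n : ∀ i j → yVar i j < 2 ℕ.* n
  yVar<2n i j = ℕₚ.<-≤-trans (ℕₚ.+-monoʳ-< n (m%n<n (2 ℕ.* n ∸ idx i ∸ idx j ℕ.+ 1) n)) (ℕₚ.≤-reflexive (sym 2n≡n+n))

  vars<2n : ∀ σ → All (_< 2 ℕ.* n) (vars σ)
  vars<2n σ = Allₚ.++⁺
    (All-map-allFin n _ _ (λ i → ℕₚ.<-≤-trans (xVar<n i (lookup σ i)) (ℕₚ.m≤m+n n (n ℕ.+ 0))))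
    (All-map-allFin n _ _ (λ i → yVar<2n i (lookup σ i)))

  diffNeMod≡xVar≢ : ∀ i j i' j' → diffNeMod n (idx i) (idx j) (idx i') (idx j') ≡ not (xVar i j ≡ᵇ xVar i' j')
  diffNeMod≡xVar≢ i j i' j' = cong₂ (λ a b → not ((a % n) ≡ᵇ (b % n)))
    (ℕₚ.+-∸-comm (idx j) (Finₚ.toℕ<n i)) (ℕₚ.+-∸-comm (idx j') (Finₚ.toℕ<n i'))

  sumNeMod≡yVar≢ : ∀ i j i' j' → sumNeMod n (idx i) (idx j) (idx i') (idx j') ≡ not (yVar i j ≡ᵇ yVar i' j')
  sumNeMod≡yVar≢ i j i' j' = cong not (sym (begin
    (yVar i j ≡ᵇ yVar i' j')
      ≡⟨ +-≡ᵇ n _ _ ⟩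
    ((2 ℕ.* n ∸ idx i ∸ idx j ℕ.+ 1) % n ≡ᵇ (2 ℕ.* n ∸ idx i' ∸ idx j' ℕ.+ 1) % n)
      ≡⟨ cong₂ (λ a b → (a % n) ≡ᵇ (b % n)) (reflected i j) (reflected i' j') ⟩
    ((K ∸ u) % n ≡ᵇ (K ∸ u') % n)
      ≡⟨ ≡ᵇ-⇔ _ _ _ _ (∸-%-reflect n' K u u' (u≤K i j) (u≤K i' j')) (∸-%-preserve n' K u u' (u≤K i j) (u≤K i' j')) ⟩
    (u % n ≡ᵇ u' % n) ∎))
    where
    open ≡-Reasoning
    K u u' : ℕ
    K  = 2 ℕ.* n ℕ.+ 1
    u  = idx i ℕ.+ idx j
    u' = idx i' ℕ.+ idx j'
    +-≡ᵇ : ∀ c a b → (c ℕ.+ a ≡ᵇ c ℕ.+ b) ≡ (a ≡ᵇ b)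
    +-≡ᵇ zero    a b = refl
    +-≡ᵇ (suc c) a b = +-≡ᵇ c a b
    idx+idx≤2n : ∀ (i j : Fin n) → idx i ℕ.+ idx j ≤ 2 ℕ.* n
    idx+idx≤2n i j = ℕₚ.≤-trans (ℕₚ.+-mono-≤ (Finₚ.toℕ<n i) (Finₚ.toℕ<n j)) (ℕₚ.≤-reflexive (sym 2n≡n+n))
    u≤K : ∀ (i j : Fin n) → idx i ℕ.+ idx j ≤ K
    u≤K i j = ℕₚ.m≤n⇒m≤n+o 1 (idx+idx≤2n i j)
    reflected : ∀ (i j : Fin n) → 2 ℕ.* n ∸ idx i ∸ idx j ℕ.+ 1 ≡ K ∸ (idx i ℕ.+ idx j)
    reflected i j = trans (cong (ℕ._+ 1) (ℕₚ.∸-+-assoc (2 ℕ.* n) (idx i) (idx j))) (sym (ℕₚ.+-∸-comm 1 (idx+idx≤2n i j)))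

  nonattacking≡distinct : ∀ σ →
    pairwiseᵇ n (onSquares σ (λ i j i' j' → diffNeMod n i j i' j' ∧ sumNeMod n i j i' j')) ≡ distinctᵇ (vars σ)
  nonattacking≡distinct σ = begin
    pairwiseᵇ n (λ i i' → onSquares σ (diffNeMod n) i i' ∧ onSquares σ (sumNeMod n) i i')
      ≡⟨ pairwiseᵇ-∧ n (onSquares σ (diffNeMod n)) (onSquares σ (sumNeMod n)) ⟩
    pairwiseᵇ n (onSquares σ (diffNeMod n)) ∧ pairwiseᵇ n (onSquares σ (sumNeMod n))
      ≡⟨ cong₂ _∧_ (pairwiseᵇ-cong n (λ i i' → diffNeMod≡xVar≢ i (lookup σ i) i' (lookup σ i')))
                   (pairwiseᵇ-cong n (λ i i' → sumNeMod≡yVar≢ i (lookup σ i) i' (lookup σ i'))) ⟩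
    pairwiseᵇ n (λ i i' → not (x i ≡ᵇ x i')) ∧ pairwiseᵇ n (λ i i' → not (y i ≡ᵇ y i'))
      ≡⟨ sym (cong₂ _∧_ (distinctᵇ-map n x) (distinctᵇ-map n y)) ⟩
    distinctᵇ (map x (allFin n)) ∧ distinctᵇ (map y (allFin n))
      ≡⟨ sym (distinctᵇ-++ n _ _ (All-map-allFin n _ x (λ i → xVar<n i (lookup σ i)))
                                  (All-map-allFin n _ y (λ i → ℕₚ.m≤m+n n _))) ⟩
    distinctᵇ (vars σ) ∎
    where
    open ≡-Reasoning
    x y : Fin n → ℕ
    x i = xVar i (lookup σ i)
    y i = yVar i (lookup σ i)

  restrictTo-sgn : ∀ k → 1 ≤ k → k ≤ 2 ℕ.* n → restrictTo (2 ℕ.* n) sgn k ≡ exactWeight (2 ℕ.* n) (2 ℕ.* n) k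
  restrictTo-sgn k 1≤k k≤2n = begin
    restrictTo (2 ℕ.* n) sgn k
      ≡⟨ cong (λ b → if b then sgn k else + 0) (inRangeᵇ-true k (2 ℕ.* n) 1≤k k≤2n) ⟩
    sgn k
      ≡⟨ sgn-parity k (2 ℕ.* n ∸ k) n (trans (ℕₚ.m+[n∸m]≡n k≤2n) 2n≡n+n) ⟩
    sgn (2 ℕ.* n ∸ k)
      ≡⟨ sym (trans (cong (λ z → sgn (2 ℕ.* n ∸ k) * + z) (nCn≡1 (2 ℕ.* n ∸ k))) (ℤₚ.*-identityʳ _)) ⟩
    sgn (2 ℕ.* n ∸ k) * + ((2 ℕ.* n ∸ k) C (2 ℕ.* n ∸ k))
      ≡⟨ sym (exactWeight-≤ (2 ℕ.* n) (2 ℕ.* n) k k≤2n) ⟩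
    exactWeight (2 ℕ.* n) (2 ℕ.* n) k ∎
    where open ≡-Reasoning

  Tc≡Trhs : + Tc n ≡ Trhs n
  Tc≡Trhs = begin
    + Tc n
      ≡⟨ placements≡∑-distinct n (λ i j i' j' → diffNeMod n i j i' j' ∧ sumNeMod n i j i' j') vars nonattacking≡distinct ⟩
    ∑[ σ ∈ perms n ] + bit (distinctᵇ (vars σ))
      ≡⟨ sym (∑-weighted-per (2 ℕ.* n) (2 ℕ.* n) (Tsub n) vars (restrictTo (2 ℕ.* n) sgn)
               (λ σ s → ∏-nth² s (allFin n) (λ i → xVar i (lookup σ i)) (λ i → yVar i (lookup σ i)))
               vars<2n (λ σ → length-map-allFin² n _ _) (s≤s z≤n) restrictTo-sgn) ⟩
    ∑[ s ∈ vecsOf bools (2 ℕ.* n) ] restrictTo (2 ℕ.* n) sgn (ones s) * + per (Tsub n s)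
      ≡⟨ sym (sumFrom1-Smk (2 ℕ.* n) (2 ℕ.* n) sgn (λ s → + per (Tsub n s))) ⟩
    sumFrom1 (2 ℕ.* n) (λ i → sgn i * ∑ (Smk (2 ℕ.* n) i) (λ s → + per (Tsub n s)))
      ≡⟨ ∑-cong (upTo (2 ℕ.* n)) (λ k → cong (sgn (suc k) *_) (sym (+sum≡∑ (λ s → per (Tsub n s)) (Smk (2 ℕ.* n) (suc k))))) ⟩
    Trhs n ∎
    where open ≡-Reasoning

module Semiqueens (n' : ℕ) where

  n m : ℕ
  n = suc n'
  m = 2 ℕ.* n ∸ 1

  m≡ : m ≡ suc (n' ℕ.+ n')
  m≡ = trans (cong (n' ℕ.+_) (ℕₚ.+-identityʳ (suc n'))) (ℕₚ.+-suc n' n')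

  -- The index d of the NW-SE diagonal through (i, j), numbered as in γ (idx j + (n-1) = idx i + d).
  diag : Fin n → Fin n → ℕ
  diag i j = idx j ℕ.+ (n ∸ 1) ∸ idx i

  diag<m : ∀ i j → diag i j < m
  diag<m i j = ℕₚ.≤-trans (s≤s (ℕₚ.≤-trans (ℕₚ.m∸n≤m (toℕ j ℕ.+ n') (toℕ i))
                                           (ℕₚ.+-monoˡ-≤ n' (ℕₚ.≤-pred (Finₚ.toℕ<n j)))))
                          (ℕₚ.≤-reflexive (sym m≡))

  diagonalMatrix : Vec Bool m → BMat n
  diagonalMatrix d = Vec.tabulate (λ i → Vec.tabulate (λ j → nth d (diag i j)))

  entry-diagonalMatrix : ∀ d i j → entry (diagonalMatrix d) i j ≡ nth d (diag i j)
  entry-diagonalMatrix d = entry-tabulate (λ i j → nth d (diag i j))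

  -- The north-west end of the diagonal with index k.
  start : ℕ → Fin n × Fin n
  start k with k ℕₚ.≤? n'
  ... | yes _ = (n' ∸ k) mod n , fzero
  ... | no  _ = fzero , (k ∸ n') mod n

  startRow startCol : ℕ → Fin n
  startRow k = proj₁ (start k)
  startCol k = proj₂ (start k)

  start-on-diagonal : ∀ k → k < m → toℕ (startCol k) ℕ.+ n' ≡ toℕ (startRow k) ℕ.+ k
  start-on-diagonal k k<m with k ℕₚ.≤? n'
  ... | yes k≤n' = trans (sym (ℕₚ.m∸n+n≡m k≤n'))
                         (cong (ℕ._+ k) (sym (toℕ-mod (n' ∸ k) n' (s≤s (ℕₚ.m∸n≤m n' k)))))
  ... | no  k≰n' = trans (cong (ℕ._+ n') (toℕ-mod (k ∸ n') n' k∸n'<n)) (ℕₚ.m∸n+n≡m n'≤k)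
    where
    n'≤k : n' ≤ k
    n'≤k = ℕₚ.<⇒≤ (ℕₚ.≰⇒> k≰n')
    k∸n'<n : k ∸ n' < n
    k∸n'<n = s≤s (ℕₚ.≤-trans (ℕₚ.∸-monoˡ-≤ n' (ℕₚ.≤-pred (ℕₚ.≤-trans k<m (ℕₚ.≤-reflexive m≡))))
                             (ℕₚ.≤-reflexive (ℕₚ.m+n∸n≡m n' n')))

  diag-start : ∀ k → k < m → diag (startRow k) (startCol k) ≡ k
  diag-start k k<m = trans (cong (_∸ toℕ (startRow k)) (start-on-diagonal k k<m)) (ℕₚ.m+n∸m≡n (toℕ (startRow k)) k)

  startRow-diag≤ : ∀ i j → toℕ (startRow (diag i j)) ≤ toℕ i
  startRow-diag≤ i j with diag i j ℕₚ.≤? n'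
  ... | no  _       = z≤n
  ... | yes diag≤n' = begin
    toℕ ((n' ∸ diag i j) mod n)       ≡⟨ toℕ-mod (n' ∸ diag i j) n' (s≤s (ℕₚ.m∸n≤m n' (diag i j))) ⟩
    n' ∸ (toℕ j ℕ.+ n' ∸ toℕ i)       ≤⟨ ℕₚ.∸-monoʳ-≤ n' (ℕₚ.∸-monoˡ-≤ (toℕ i) (ℕₚ.m≤n+m n' (toℕ j))) ⟩
    n' ∸ (n' ∸ toℕ i)                 ≡⟨ ℕₚ.m∸[m∸n]≡n (ℕₚ.≤-pred (Finₚ.toℕ<n i)) ⟩
    toℕ i ∎
    where open ℕₚ.≤-Reasoning

  diagConst-step : ∀ M → diagConstᵇ M ≡ true → ∀ (i j i' j' : Fin n) →
    toℕ i' ≡ suc (toℕ i) → toℕ j' ≡ suc (toℕ j) → entry M i j ≡ entry M i' j'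
  diagConst-step M const i j i' j' i'≡ j'≡ = beq-sound _ _ (trans
    (sym (cong₂ (λ a b → not (a ∧ b) ∨ beq (entry M i j) (entry M i' j'))
                (≡⇒≡ᵇ-true (idx i') (idx i ℕ.+ 1) (trans (cong suc i'≡) (ℕₚ.+-comm 1 (idx i))))
                (≡⇒≡ᵇ-true (idx j') (idx j ℕ.+ 1) (trans (cong suc j'≡) (ℕₚ.+-comm 1 (idx j))))))
    (allB-allFin-elim n _ (allB-allFin-elim n _ (allB-allFin-elim n _ (allB-allFin-elim n _ const i) j) i') j'))

  diagConst-shift : ∀ M → diagConstᵇ M ≡ true → ∀ t (i j i' j' : Fin n) →
    toℕ i' ≡ t ℕ.+ toℕ i → toℕ j' ≡ t ℕ.+ toℕ j → entry M i j ≡ entry M i' j'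
  diagConst-shift M const zero    i j i' j' i'≡ j'≡ =
    cong₂ (entry M) (Finₚ.toℕ-injective (sym i'≡)) (Finₚ.toℕ-injective (sym j'≡))
  diagConst-shift M const (suc t) i j i' j' i'≡ j'≡ = trans
    (diagConst-shift M const t i j (fromℕ< t+i<n) (fromℕ< t+j<n) (Finₚ.toℕ-fromℕ< t+i<n) (Finₚ.toℕ-fromℕ< t+j<n))
    (diagConst-step M const (fromℕ< t+i<n) (fromℕ< t+j<n) i' j'
      (trans i'≡ (cong suc (sym (Finₚ.toℕ-fromℕ< t+i<n)))) (trans j'≡ (cong suc (sym (Finₚ.toℕ-fromℕ< t+j<n)))))
    where
    t+i<n : t ℕ.+ toℕ i < n
    t+i<n = ℕₚ.≤-trans (ℕₚ.≤-reflexive (sym i'≡)) (ℕₚ.<⇒≤ (Finₚ.toℕ<n i'))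
    t+j<n : t ℕ.+ toℕ j < n
    t+j<n = ℕₚ.≤-trans (ℕₚ.≤-reflexive (sym j'≡)) (ℕₚ.<⇒≤ (Finₚ.toℕ<n j'))

  diagonals : BMat n → Vec Bool m
  diagonals M = Vec.tabulate (λ k → entry M (startRow (toℕ k)) (startCol (toℕ k)))

  diagonals-diagonalMatrix : ∀ d → diagonals (diagonalMatrix d) ≡ d
  diagonals-diagonalMatrix d = vec-ext (diagonals (diagonalMatrix d)) d (λ k → begin
    lookup (diagonals (diagonalMatrix d)) k              ≡⟨ Vecₚ.lookup∘tabulate _ k ⟩
    entry (diagonalMatrix d) (startRow (toℕ k)) (startCol (toℕ k))
                                                         ≡⟨ entry-diagonalMatrix d (startRow (toℕ k)) (startCol (toℕ k)) ⟩
    nth d (diag (startRow (toℕ k)) (startCol (toℕ k)))   ≡⟨ cong (nth d) (diag-start (toℕ k) (Finₚ.toℕ<n k)) ⟩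
    nth d (toℕ k)                                        ≡⟨ nth-lookup d k ⟩
    lookup d k ∎)
    where open ≡-Reasoning

  -- (i, j) lies on diagonal κ, t = i - startRow κ steps below its north-west end.
  diagonalMatrix-diagonals : ∀ M → diagConstᵇ M ≡ true → diagonalMatrix (diagonals M) ≡ M
  diagonalMatrix-diagonals M const = bmat-ext (diagonalMatrix (diagonals M)) M (λ i j → begin
    entry (diagonalMatrix (diagonals M)) i j
      ≡⟨ entry-diagonalMatrix (diagonals M) i j ⟩
    nth (diagonals M) (diag i j)
      ≡⟨ trans (nth-fromℕ< (diagonals M) (diag i j) (diag<m i j)) (Vecₚ.lookup∘tabulate _ (fromℕ< (diag<m i j))) ⟩
    entry M (startRow (toℕ (fromℕ< (diag<m i j)))) (startCol (toℕ (fromℕ< (diag<m i j))))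
      ≡⟨ cong (λ z → entry M (startRow z) (startCol z)) (Finₚ.toℕ-fromℕ< (diag<m i j)) ⟩
    entry M (startRow (diag i j)) (startCol (diag i j))
      ≡⟨ diagConst-shift M const (toℕ i ∸ toℕ (startRow (diag i j))) _ _ i j
           (sym (ℕₚ.m∸n+n≡m (startRow-diag≤ i j))) (j≡ i j) ⟩
    entry M i j ∎)
    where
    open ≡-Reasoning
    j≡ : ∀ i j → toℕ j ≡ (toℕ i ∸ toℕ (startRow (diag i j))) ℕ.+ toℕ (startCol (diag i j))
    j≡ i j = ℕₚ.+-cancelʳ-≡ n' (toℕ j) _ (sym (begin
      (r ∸ a) ℕ.+ b ℕ.+ n'   ≡⟨ ℕₚ.+-assoc (r ∸ a) b n' ⟩
      (r ∸ a) ℕ.+ (b ℕ.+ n') ≡⟨ cong ((r ∸ a) ℕ.+_) (start-on-diagonal κ (diag<m i j)) ⟩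
      (r ∸ a) ℕ.+ (a ℕ.+ κ)  ≡⟨ sym (ℕₚ.+-assoc (r ∸ a) a κ) ⟩
      (r ∸ a) ℕ.+ a ℕ.+ κ    ≡⟨ cong (ℕ._+ κ) (ℕₚ.m∸n+n≡m (startRow-diag≤ i j)) ⟩
      r ℕ.+ κ                ≡⟨ ℕₚ.m+[n∸m]≡n i≤j+n' ⟩
      toℕ j ℕ.+ n' ∎))
      where
      κ a b r : ℕ
      κ = diag i j
      a = toℕ (startRow κ)
      b = toℕ (startCol κ)
      r = toℕ i
      i≤j+n' : toℕ i ≤ toℕ j ℕ.+ n'
      i≤j+n' = ℕₚ.≤-trans (ℕₚ.≤-pred (Finₚ.toℕ<n i)) (ℕₚ.m≤n+m n' (toℕ j))

  diag-suc : ∀ i j i' j' → toℕ i' ≡ suc (toℕ i) → toℕ j' ≡ suc (toℕ j) → diag i' j' ≡ diag i j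
  diag-suc i j i' j' i'≡ j'≡ = cong₂ (λ a b → b ℕ.+ n' ∸ a) i'≡ j'≡

  diagConst-diagonalMatrix : ∀ d → diagConstᵇ (diagonalMatrix d) ≡ true
  diagConst-diagonalMatrix d = allB-allFin-intro n _ λ i → allB-allFin-intro n _ λ j →
    allB-allFin-intro n _ λ i' → allB-allFin-intro n _ λ j' → constant i j i' j'
    where
    constant : ∀ i j i' j' → not ((idx i' ≡ᵇ idx i ℕ.+ 1) ∧ (idx j' ≡ᵇ idx j ℕ.+ 1))
                               ∨ beq (entry (diagonalMatrix d) i j) (entry (diagonalMatrix d) i' j') ≡ true
    constant i j i' j' with idx i' ≡ᵇ idx i ℕ.+ 1 in i'≡ | idx j' ≡ᵇ idx j ℕ.+ 1 in j'≡
    ... | false | _     = refl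
    ... | true  | false = refl
    ... | true  | true  = trans
      (cong₂ beq (entry-diagonalMatrix d i j)
                 (trans (entry-diagonalMatrix d i' j')
                        (cong (nth d) (diag-suc i j i' j' (idx-step i i' (≡ᵇ-true⇒≡ _ _ i'≡))
                                                          (idx-step j j' (≡ᵇ-true⇒≡ _ _ j'≡))))))
      (beq-refl (nth d (diag i j)))

  γ-diagonalMatrix : ∀ d → γ (diagonalMatrix d) ≡ ones d
  γ-diagonalMatrix d = countB-applyUpTo d (λ k → k) _ full≡nth
    where
    full≡nth : ∀ k → k < m → allB (allFin n) (λ i → allB (allFin n) (λ j →
      not (idx j ℕ.+ (n ∸ 1) ≡ᵇ idx i ℕ.+ k) ∨ entry (diagonalMatrix d) i j)) ≡ nth d k
    full≡nth k k<m = bool-ext to from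
      where
      to : _ → nth d k ≡ true
      to full = begin
        nth d k                                           ≡⟨ cong (nth d) (sym (diag-start k k<m)) ⟩
        nth d (diag (startRow k) (startCol k))            ≡⟨ sym (entry-diagonalMatrix d (startRow k) (startCol k)) ⟩
        entry (diagonalMatrix d) (startRow k) (startCol k)
          ≡⟨ cong (λ c → not c ∨ entry (diagonalMatrix d) (startRow k) (startCol k))
                  (sym (≡⇒≡ᵇ-true _ _ (cong suc (start-on-diagonal k k<m)))) ⟩
        _                                                 ≡⟨ allB-allFin-elim n _ (allB-allFin-elim n _ full (startRow k)) (startCol k) ⟩
        true ∎
        where open ≡-Reasoning
      from : nth d k ≡ true → _
      from dk≡true = allB-allFin-intro n _ λ i → allB-allFin-intro n _ λ j → on-diagonal i j
        where
        on-diagonal : ∀ i j → not (idx j ℕ.+ (n ∸ 1) ≡ᵇ idx i ℕ.+ k) ∨ entry (diagonalMatrix d) i j ≡ true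
        on-diagonal i j with idx j ℕ.+ (n ∸ 1) ≡ᵇ idx i ℕ.+ k in on
        ... | false = refl
        ... | true  = trans (entry-diagonalMatrix d i j) (trans (cong (nth d)
          (trans (cong (_∸ idx i) (≡ᵇ-true⇒≡ (idx j ℕ.+ (n ∸ 1)) (idx i ℕ.+ k) on)) (ℕₚ.m+n∸m≡n (idx i) k))) dk≡true)

  vars : Vec (Fin n) n → List ℕ
  vars σ = map (λ i → diag i (lookup σ i)) (allFin n)

  diag-ℤ : ∀ i j → + diag i j ≡ + toℕ j + + n' - + toℕ i
  diag-ℤ i j = trans (pos-∸ (toℕ j ℕ.+ n') (toℕ i) (ℕₚ.≤-trans (ℕₚ.≤-pred (Finₚ.toℕ<n i)) (ℕₚ.m≤n+m n' (toℕ j))))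
                     (cong (_- + toℕ i) (ℤₚ.pos-+ (toℕ j) n'))

  diffNe≡diag≢ : ∀ i j i' j' → diffNe (idx i) (idx j) (idx i') (idx j') ≡ not (diag i j ≡ᵇ diag i' j')
  diffNe≡diag≢ i j i' j' = cong not (≡ᵇ-⇔ a b c d
    (≡-from-differences a b c d difference≡) (≡-from-differences c d a b (sym difference≡)))
    where
    a b c d : ℕ
    a = idx j ℕ.+ idx i'
    b = idx j' ℕ.+ idx i
    c = diag i j
    d = diag i' j'
    difference≡ : + a - + b ≡ + c - + d
    difference≡ = begin
      + a - + b
        ≡⟨ cong₂ _-_ (ℤₚ.pos-+ (idx j) (idx i')) (ℤₚ.pos-+ (idx j') (idx i)) ⟩
      (+ 1 + + toℕ j + (+ 1 + + toℕ i')) - (+ 1 + + toℕ j' + (+ 1 + + toℕ i))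
        ≡⟨ solve 5 (λ N x y x' y' → (con (+ 1) :+ y :+ (con (+ 1) :+ x')) :- (con (+ 1) :+ y' :+ (con (+ 1) :+ x))
                                     := (y :+ N :- x) :- (y' :+ N :- x'))
             refl (+ n') (+ toℕ i) (+ toℕ j) (+ toℕ i') (+ toℕ j') ⟩
      (+ toℕ j + + n' - + toℕ i) - (+ toℕ j' + + n' - + toℕ i')
        ≡⟨ sym (cong₂ _-_ (diag-ℤ i j) (diag-ℤ i' j')) ⟩
      + c - + d ∎
      where open ≡-Reasoning

  weight : ℕ → ℤ
  weight k = sgn (k ℕ.+ n) * + binomZ (2 ℕ.* n ∸ k ∸ 1) ((+ n) - (+ k))

  weight≡exactWeight : ∀ k → 1 ≤ k → k ≤ m → weight k ≡ exactWeight m n k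
  weight≡exactWeight k _ _ with k ℕₚ.≤? n
  ... | yes k≤n = begin
    sgn (k ℕ.+ n) * + binomZ (2 ℕ.* n ∸ k ∸ 1) ((+ n) - (+ k))
      ≡⟨ cong (λ z → sgn (k ℕ.+ n) * + binomZ (2 ℕ.* n ∸ k ∸ 1) z) (sym (pos-∸ n k k≤n)) ⟩
    sgn (k ℕ.+ n) * + ((2 ℕ.* n ∸ k ∸ 1) C (n ∸ k))
      ≡⟨ cong₂ (λ a b → a * + (b C (n ∸ k))) (sgn-parity (k ℕ.+ n) (n ∸ k) n parity)
           (∸-∸-comm (2 ℕ.* n) k 1) ⟩
    sgn (n ∸ k) * + ((m ∸ k) C (n ∸ k))
      ≡⟨ sym (exactWeight-≤ m n k k≤n) ⟩
    exactWeight m n k ∎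
    where
    open ≡-Reasoning
    parity : k ℕ.+ n ℕ.+ (n ∸ k) ≡ n ℕ.+ n
    parity = begin
      k ℕ.+ n ℕ.+ (n ∸ k)   ≡⟨ ℕₚ.+-assoc k n (n ∸ k) ⟩
      k ℕ.+ (n ℕ.+ (n ∸ k)) ≡⟨ cong (k ℕ.+_) (ℕₚ.+-comm n (n ∸ k)) ⟩
      k ℕ.+ ((n ∸ k) ℕ.+ n) ≡⟨ sym (ℕₚ.+-assoc k (n ∸ k) n) ⟩
      k ℕ.+ (n ∸ k) ℕ.+ n   ≡⟨ cong (ℕ._+ n) (ℕₚ.m+[n∸m]≡n k≤n) ⟩
      n ℕ.+ n ∎
  ... | no k≰n = begin
    sgn (k ℕ.+ n) * + binomZ (2 ℕ.* n ∸ k ∸ 1) ((+ n) - (+ k))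
      ≡⟨ cong (λ z → sgn (k ℕ.+ n) * + binomZ (2 ℕ.* n ∸ k ∸ 1) z) negative ⟩
    sgn (k ℕ.+ n) * + 0
      ≡⟨ ℤₚ.*-zeroʳ (sgn (k ℕ.+ n)) ⟩
    + 0
      ≡⟨ sym (exactWeight-> m n k (ℕₚ.≰⇒> k≰n)) ⟩
    exactWeight m n k ∎
    where
    open ≡-Reasoning
    negative : (+ n) - (+ k) ≡ -[1+ (k ∸ suc n) ]
    negative = trans (ℤₚ.m-n≡m⊖n n k)
      (trans (ℤₚ.⊖-< (ℕₚ.≰⇒> k≰n)) (cong (λ z → - (+ z)) (ℕₚ.+-∸-assoc 1 (ℕₚ.≰⇒> k≰n))))

  summand : BMat n → ℤ
  summand M = sgn (γ M ℕ.+ n) * + per (toMat M) * + binomZ (2 ℕ.* n ∸ γ M ∸ 1) ((+ n) - (+ γ M))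

  Sc≡Srhs : + Sc n ≡ Srhs n
  Sc≡Srhs = begin
    + Sc n
      ≡⟨ placements≡∑-distinct n diffNe vars (λ σ → sym (trans (distinctᵇ-map n _)
           (pairwiseᵇ-cong n (λ i i' → sym (diffNe≡diag≢ i (lookup σ i) i' (lookup σ i')))))) ⟩
    ∑[ σ ∈ perms n ] + bit (distinctᵇ (vars σ))
      ≡⟨ sym (∑-weighted-per m n (toMat ∘ diagonalMatrix) vars weight term≡
               (λ σ → All-map-allFin n _ _ (λ i → diag<m i (lookup σ i)))
               (λ σ → length-map-allFin n _)
               (s≤s z≤n) weight≡exactWeight) ⟩
    ∑[ d ∈ vecsOf bools m ] weight (ones d) * + per (toMat (diagonalMatrix d))
      ≡⟨ ∑-cong (vecsOf bools m) reorder ⟩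
    ∑ (vecsOf bools m) (summand ∘ diagonalMatrix)
      ≡⟨ sym (∑-filter-bijection (Vecₚ.≡-dec (Vecₚ.≡-dec Boolₚ._≟_)) (Vecₚ.≡-dec Boolₚ._≟_)
               (allBMats n) (vecsOf bools m)
               (enumerates-vecsOf _ (vecsOf bools n) (enumerates-vecsOf _ bools enumerates-bools n) n)
               (enumerates-vecsOf _ bools enumerates-bools m)
               diagConstᵇ diagonalMatrix diagonals diagConst-diagonalMatrix diagonalMatrix-diagonals
               diagonals-diagonalMatrix summand) ⟩
    Srhs n ∎
    where
    open ≡-Reasoning
    term≡ : ∀ σ d → diagonalProduct σ (toMat (diagonalMatrix d)) ≡ bit (allB (vars σ) (nth d))
    term≡ σ d = trans (cong ℕprod (Listₚ.map-cong (λ i → cong bit (entry-diagonalMatrix d i (lookup σ i))) (allFin n)))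
                      (∏-nth d (allFin n) (λ i → diag i (lookup σ i)))
    reorder : ∀ d → weight (ones d) * + per (toMat (diagonalMatrix d)) ≡ summand (diagonalMatrix d)
    reorder d rewrite γ-diagonalMatrix d =
      solve 3 (λ s b p → s :* b :* p := s :* p :* b) refl
        (sgn (ones d ℕ.+ n)) (+ binomZ (2 ℕ.* n ∸ ones d ∸ 1) ((+ n) - (+ ones d))) (+ per (toMat (diagonalMatrix d)))

module ToroidalSemiqueens (n' : ℕ) where

  n : ℕ
  n = suc n'

  %-absorbʳ : ∀ x y → (x ℕ.+ y % n) % n ≡ (x ℕ.+ y) % n
  %-absorbʳ x y = trans (%-distribˡ-+ x (y % n) n)
    (trans (cong (λ z → (x % n ℕ.+ z) % n) (m%n%n≡m%n y n)) (sym (%-distribˡ-+ x y n)))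

  %-absorbˡ : ∀ x y → (x % n ℕ.+ y) % n ≡ (x ℕ.+ y) % n
  %-absorbˡ x y = trans (cong (_% n) (ℕₚ.+-comm (x % n) y)) (trans (%-absorbʳ y x) (cong (_% n) (ℕₚ.+-comm y x)))

  [n+x]%n : ∀ x → (n ℕ.+ x) % n ≡ x % n
  [n+x]%n x = trans (cong (_% n) (ℕₚ.+-comm n x)) ([m+n]%n≡m%n x n)

  -- The index r of the broken diagonal through (i, j), i.e. j - i ≡ r (mod n).
  cdiag : Fin n → Fin n → ℕ
  cdiag i j = (n ℕ.+ idx j ∸ idx i) % n

  cdiag<n : ∀ i j → cdiag i j < n
  cdiag<n i j = m%n<n (n ℕ.+ idx j ∸ idx i) n

  cdiag-zero : ∀ j → cdiag fzero j ≡ toℕ j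
  cdiag-zero j = trans (cong (λ z → (z ∸ 1) % n) (ℕₚ.+-suc n (toℕ j))) (trans ([n+x]%n (toℕ j)) (m<n⇒m%n≡m (Finₚ.toℕ<n j)))

  cdiag-suc : ∀ i j i' j' → toℕ i' ≡ (toℕ i ℕ.+ 1) % n → toℕ j' ≡ (toℕ j ℕ.+ 1) % n → cdiag i' j' ≡ cdiag i j
  cdiag-suc i j i' j' i'≡ j'≡ = %-cancel-+ˡ n' (idx i ℕ.+ 1) (X i' j') (X i j) (begin
    (idx i ℕ.+ 1 ℕ.+ X i' j') % n ≡⟨ %-cong-+ʳ n' (idx i ℕ.+ 1) (idx i') (X i' j') (sym (idx-mod i i' i'≡)) ⟩
    (idx i' ℕ.+ X i' j') % n      ≡⟨ cong (_% n) (trans (ℕₚ.+-comm (idx i') (X i' j')) (X+idx i' j')) ⟩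
    (n ℕ.+ idx j') % n            ≡⟨ [n+x]%n (idx j') ⟩
    idx j' % n                    ≡⟨ idx-mod j j' j'≡ ⟩
    (idx j ℕ.+ 1) % n             ≡⟨ sym ([n+x]%n (idx j ℕ.+ 1)) ⟩
    (n ℕ.+ (idx j ℕ.+ 1)) % n     ≡⟨ cong (_% n) (sym (ℕₚ.+-assoc n (idx j) 1)) ⟩
    (n ℕ.+ idx j ℕ.+ 1) % n       ≡⟨ cong (λ z → (z ℕ.+ 1) % n) (sym (X+idx i j)) ⟩
    (X i j ℕ.+ idx i ℕ.+ 1) % n   ≡⟨ cong (_% n) (trans (ℕₚ.+-assoc (X i j) (idx i) 1) (ℕₚ.+-comm (X i j) (idx i ℕ.+ 1))) ⟩
    (idx i ℕ.+ 1 ℕ.+ X i j) % n ∎)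
    where
    open ≡-Reasoning
    X : Fin n → Fin n → ℕ
    X i j = n ℕ.+ idx j ∸ idx i
    X+idx : ∀ i j → X i j ℕ.+ idx i ≡ n ℕ.+ idx j
    X+idx i j = ℕₚ.m∸n+n≡m (ℕₚ.≤-trans (Finₚ.toℕ<n i) (ℕₚ.m≤m+n n (idx j)))
    idx-mod : ∀ (i i' : Fin n) → toℕ i' ≡ (toℕ i ℕ.+ 1) % n → idx i' % n ≡ (idx i ℕ.+ 1) % n
    idx-mod i i' i'≡ = trans (cong (λ z → suc z % n) i'≡) (%-absorbʳ 1 (toℕ i ℕ.+ 1))

  circulant : Vec Bool n → BMat n
  circulant r = Vec.tabulate (λ i → Vec.tabulate (λ j → nth r (cdiag i j)))

  entry-circulant : ∀ r i j → entry (circulant r) i j ≡ nth r (cdiag i j)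
  entry-circulant r = entry-tabulate (λ i j → nth r (cdiag i j))

  circ-circulant : ∀ r → circᵇ (circulant r) ≡ true
  circ-circulant r = allB-allFin-intro n _ λ i → allB-allFin-intro n _ λ j →
    allB-allFin-intro n _ λ i' → allB-allFin-intro n _ λ j' → constant i j i' j'
    where
    constant : ∀ i j i' j' → not ((toℕ i' ≡ᵇ modn n (toℕ i ℕ.+ 1)) ∧ (toℕ j' ≡ᵇ modn n (toℕ j ℕ.+ 1)))
                               ∨ beq (entry (circulant r) i j) (entry (circulant r) i' j') ≡ true
    constant i j i' j' with toℕ i' ≡ᵇ modn n (toℕ i ℕ.+ 1) in i'≡ | toℕ j' ≡ᵇ modn n (toℕ j ℕ.+ 1) in j'≡
    ... | false | _     = refl
    ... | true  | false = refl
    ... | true  | true  = trans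
      (cong₂ beq (entry-circulant r i j)
                 (trans (entry-circulant r i' j') (cong (nth r) (cdiag-suc i j i' j' (≡ᵇ-true⇒≡ _ _ i'≡) (≡ᵇ-true⇒≡ _ _ j'≡)))))
      (beq-refl (nth r (cdiag i j)))

  circ-step : ∀ M → circᵇ M ≡ true → ∀ (i j i' j' : Fin n) →
    toℕ i' ≡ (toℕ i ℕ.+ 1) % n → toℕ j' ≡ (toℕ j ℕ.+ 1) % n → entry M i j ≡ entry M i' j'
  circ-step M circ i j i' j' i'≡ j'≡ = beq-sound _ _ (trans
    (sym (cong₂ (λ a b → not (a ∧ b) ∨ beq (entry M i j) (entry M i' j')) (≡⇒≡ᵇ-true _ _ i'≡) (≡⇒≡ᵇ-true _ _ j'≡)))
    (allB-allFin-elim n _ (allB-allFin-elim n _ (allB-allFin-elim n _ (allB-allFin-elim n _ circ i) j) i') j'))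

  -- Walking (i, j) back to row 0 along its broken diagonal, one step (i-1, j-1 mod n) at a time.
  circ-entry : ∀ M → circᵇ M ≡ true → ∀ t (i j : Fin n) → toℕ i ≡ t → entry M i j ≡ entry M fzero (fromℕ< (cdiag<n i j))
  circ-entry M circ zero i j i≡0 = cong₂ (entry M) (Finₚ.toℕ-injective i≡0)
    (Finₚ.toℕ-injective (sym (trans (Finₚ.toℕ-fromℕ< (cdiag<n i j))
      (trans (cong (λ z → cdiag z j) (Finₚ.toℕ-injective i≡0)) (cdiag-zero j)))))
  circ-entry M circ (suc t) i j i≡ = begin
    entry M i j                               ≡⟨ sym (circ-step M circ i₀ j₀ i j i≡i₀+1 j≡j₀+1) ⟩
    entry M i₀ j₀                             ≡⟨ circ-entry M circ t i₀ j₀ (Finₚ.toℕ-fromℕ< t<n) ⟩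
    entry M fzero (fromℕ< (cdiag<n i₀ j₀))
      ≡⟨ cong (entry M fzero) (Finₚ.toℕ-injective (trans (Finₚ.toℕ-fromℕ< (cdiag<n i₀ j₀))
           (trans (sym (cdiag-suc i₀ j₀ i j i≡i₀+1 j≡j₀+1)) (sym (Finₚ.toℕ-fromℕ< (cdiag<n i j)))))) ⟩
    entry M fzero (fromℕ< (cdiag<n i j)) ∎
    where
    open ≡-Reasoning
    t<n : t < n
    t<n = ℕₚ.≤-trans (ℕₚ.≤-reflexive (sym i≡)) (ℕₚ.<⇒≤ (Finₚ.toℕ<n i))
    i₀ j₀ : Fin n
    i₀ = fromℕ< t<n
    j₀ = fromℕ< (m%n<n (toℕ j ℕ.+ n') n)
    i≡i₀+1 : toℕ i ≡ (toℕ i₀ ℕ.+ 1) % n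
    i≡i₀+1 = begin
      toℕ i                ≡⟨ i≡ ⟩
      suc t                ≡⟨ sym (m<n⇒m%n≡m (ℕₚ.≤-trans (ℕₚ.≤-reflexive (cong suc (sym i≡))) (Finₚ.toℕ<n i))) ⟩
      suc t % n            ≡⟨ cong (λ z → z % n) (trans (cong suc (sym (Finₚ.toℕ-fromℕ< t<n))) (ℕₚ.+-comm 1 (toℕ i₀))) ⟩
      (toℕ i₀ ℕ.+ 1) % n ∎
    j≡j₀+1 : toℕ j ≡ (toℕ j₀ ℕ.+ 1) % n
    j≡j₀+1 = sym (begin
      (toℕ j₀ ℕ.+ 1) % n                 ≡⟨ cong (λ z → (z ℕ.+ 1) % n) (Finₚ.toℕ-fromℕ< (m%n<n (toℕ j ℕ.+ n') n)) ⟩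
      ((toℕ j ℕ.+ n') % n ℕ.+ 1) % n     ≡⟨ %-absorbˡ (toℕ j ℕ.+ n') 1 ⟩
      (toℕ j ℕ.+ n' ℕ.+ 1) % n           ≡⟨ cong (_% n) (trans (ℕₚ.+-assoc (toℕ j) n' 1)
                                                               (cong (toℕ j ℕ.+_) (ℕₚ.+-comm n' 1))) ⟩
      (toℕ j ℕ.+ n) % n                  ≡⟨ [m+n]%n≡m%n (toℕ j) n ⟩
      toℕ j % n                          ≡⟨ m<n⇒m%n≡m (Finₚ.toℕ<n j) ⟩
      toℕ j ∎)

  head≡lookup-zero : ∀ (M : BMat n) → Vec.head M ≡ lookup M fzero
  head≡lookup-zero (r ∷ M) = refl

  circulant-head : ∀ M → circᵇ M ≡ true → circulant (Vec.head M) ≡ M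
  circulant-head M circ = bmat-ext (circulant (Vec.head M)) M (λ i j → begin
    entry (circulant (Vec.head M)) i j               ≡⟨ entry-circulant (Vec.head M) i j ⟩
    nth (Vec.head M) (cdiag i j)                     ≡⟨ nth-fromℕ< (Vec.head M) (cdiag i j) (cdiag<n i j) ⟩
    lookup (Vec.head M) (fromℕ< (cdiag<n i j))       ≡⟨ cong (λ r → lookup r (fromℕ< (cdiag<n i j))) (head≡lookup-zero M) ⟩
    entry M fzero (fromℕ< (cdiag<n i j))             ≡⟨ sym (circ-entry M circ (toℕ i) i j refl) ⟩
    entry M i j ∎)
    where open ≡-Reasoning

  head-circulant : ∀ r → Vec.head (circulant r) ≡ r
  head-circulant r = vec-ext (Vec.head (circulant r)) r (λ k → begin
    lookup (Vec.head (circulant r)) k ≡⟨ cong (λ z → lookup z k) (head≡lookup-zero (circulant r)) ⟩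
    entry (circulant r) fzero k       ≡⟨ entry-circulant r fzero k ⟩
    nth r (cdiag fzero k)             ≡⟨ cong (nth r) (cdiag-zero k) ⟩
    nth r (toℕ k)                     ≡⟨ nth-lookup r k ⟩
    lookup r k ∎)
    where open ≡-Reasoning

  vars : Vec (Fin n) n → List ℕ
  vars σ = map (λ i → cdiag i (lookup σ i)) (allFin n)

  sgn≡exactWeight : ∀ k → 1 ≤ k → k ≤ n → sgn (k ℕ.+ n) ≡ exactWeight n n k
  sgn≡exactWeight k _ k≤n = begin
    sgn (k ℕ.+ n)                    ≡⟨ sgn-parity (k ℕ.+ n) (n ∸ k) n parity ⟩
    sgn (n ∸ k)                      ≡⟨ sym (trans (cong (λ z → sgn (n ∸ k) * + z) (nCn≡1 (n ∸ k))) (ℤₚ.*-identityʳ _)) ⟩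
    sgn (n ∸ k) * + ((n ∸ k) C (n ∸ k)) ≡⟨ sym (exactWeight-≤ n n k k≤n) ⟩
    exactWeight n n k ∎
    where
    open ≡-Reasoning
    parity : k ℕ.+ n ℕ.+ (n ∸ k) ≡ n ℕ.+ n
    parity = trans (ℕₚ.+-assoc k n (n ∸ k)) (trans (cong (k ℕ.+_) (ℕₚ.+-comm n (n ∸ k)))
      (trans (sym (ℕₚ.+-assoc k (n ∸ k) n)) (cong (ℕ._+ n) (ℕₚ.m+[n∸m]≡n k≤n))))

  summand : BMat n → ℤ
  summand M = sgn (σ₁ M ℕ.+ n) * + per (toMat M)

  TSc≡TSrhs : + TSc n ≡ TSrhs n
  TSc≡TSrhs = begin
    + TSc n
      ≡⟨ placements≡∑-distinct n (diffNeMod n) vars (λ σ → sym (distinctᵇ-map n _)) ⟩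
    ∑[ σ ∈ perms n ] + bit (distinctᵇ (vars σ))
      ≡⟨ sym (∑-weighted-per n n (toMat ∘ circulant) vars (λ k → sgn (k ℕ.+ n)) term≡
               (λ σ → All-map-allFin n _ _ (λ i → cdiag<n i (lookup σ i)))
               (λ σ → length-map-allFin n _)
               (s≤s z≤n) sgn≡exactWeight) ⟩
    ∑[ r ∈ vecsOf bools n ] sgn (ones r ℕ.+ n) * + per (toMat (circulant r))
      ≡⟨ ∑-cong (vecsOf bools n) (λ r → cong (λ z → sgn (z ℕ.+ n) * + per (toMat (circulant r))) (sym (σ₁-circulant r))) ⟩
    ∑ (vecsOf bools n) (summand ∘ circulant)
      ≡⟨ sym (∑-filter-bijection (Vecₚ.≡-dec (Vecₚ.≡-dec Boolₚ._≟_)) (Vecₚ.≡-dec Boolₚ._≟_)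
               (allBMats n) (vecsOf bools n)
               (enumerates-vecsOf _ (vecsOf bools n) (enumerates-vecsOf _ bools enumerates-bools n) n)
               (enumerates-vecsOf _ bools enumerates-bools n)
               circᵇ circulant Vec.head circ-circulant circulant-head head-circulant summand) ⟩
    TSrhs n ∎
    where
    open ≡-Reasoning
    term≡ : ∀ σ r → diagonalProduct σ (toMat (circulant r)) ≡ bit (allB (vars σ) (nth r))
    term≡ σ r = trans (cong ℕprod (Listₚ.map-cong (λ i → cong bit (entry-circulant r i (lookup σ i))) (allFin n)))
                      (∏-nth r (allFin n) (λ i → cdiag i (lookup σ i)))
    σ₁-circulant : ∀ r → σ₁ (circulant r) ≡ ones r
    σ₁-circulant r = trans (countB-ones (Vec.head (circulant r))) (cong ones (head-circulant r))

theorem3p6 : (n : ℕ) → 1 ≤ n →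
    ((+ Qc n) ≡ Qrhs n) × ((+ Tc n) ≡ Trhs n) × ((+ Sc n) ≡ Srhs n) × ((+ TSc n) ≡ TSrhs n)
theorem3p6 (suc n') 1≤n =
  Queens.Qc≡Qrhs (suc n') 1≤n , ToroidalQueens.Tc≡Trhs n' , Semiqueens.Sc≡Srhs n' , ToroidalSemiqueens.TSc≡TSrhs n'
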